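{- Let $k\ge4$ be an integer, $m=2^k-1$ and $m'=2^{k-3}-1$. Let $Q_m=Q(f_{m+1},(1,f_m))=\{\boldsymbol{x}_0,\ldots,\boldsymbol{x}_{2^m-1}\}$ be the Fibonacci polynomial lattice point set with $2^m$ points. Then for $n=2^{m-m'-2}-2^{m'-1}$ and $n'=2^{m-m'-2}+2^{m'-1}$, \[ \|\boldsymbol{x}_n-\boldsymbol{x}_{n'}\|_\infty=2^{ -m+m'}. \] In particular, with $N=2^m$, the separation radius satisfies $q_\infty(Q_m)\le2^{ -15/8}N^{ -7/8}$.
   Context: Fibonacci polynomials over $\mathbb{F}_2$: $f_1=1$, $f_2=x$, $f_{n+2}=xf_{n+1}+f_n$ (so $\deg f_n=n-1$). Polynomial lattice point set in base 2: for $p,q_1,q_2\in\mathbb{F}_2[x]$ with $m=\deg p$, and for $0\le n<2^m$ with binary expansion $n=n_0+2n_1+\cdots+2^{m-1}n_{m-1}$, let $n(x)=n_0+n_1x+\cdots+n_{m-1}x^{m-1}$ and $\boldsymbol{x}_n=\left(\nu_m\!\left(\frac{n(x)q_1(x)}{p(x)}\right),\nu_m\!\left(\frac{n(x)q_2(x)}{p(x)}\right)\right)$, where for a Laurent series $\sum_{i=w}^\infty t_ix^{ -i}\in\mathbb{F}_2((x^{ -1}))$, $\nu_m\left(\sum_{i=w}^\infty t_ix^{ -i}\right)=\sum_{i=\max(w,1)}^m t_i2^{ -i}\in[0,1)$. $Q(p,(q_1,q_2))=\{\boldsymbol{x}_n:0\le n<2^m\}$. $q_\infty(Q)=\min_{\boldsymbol{x}\ne\boldsymbol{y}\in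 Q}\|\boldsymbol{x}-\boldsymbol{y}\|_\infty/2$. -}

module Defs where

open import Data.Bool using (Bool; true; false; _xor_; _∧_; if_then_else_)
open import Data.List using (List; []; _∷_; reverse; take; replicate; _++_; map; concatMap; foldr; upTo)
open import Data.Nat as ℕ using (ℕ; zero; suc; _∸_; _^_; _%_)
import Data.Nat.Properties as ℕP
open import Data.Integer using (+_)
open import Data.Rational using (ℚ; _/_; _-_; ∣_∣; _⊔_; _⊓_; _*_; 1ℚ; 0ℚ)
open import Data.Rational.Properties using (_≟_)
open import Data.Product using (_×_; _,_; proj₁; proj₂)
open import Data.Maybe using (Maybe; just; nothing)
open import Relation.Nullary using (yes; no)

-- Polynomials over F₂: coefficient lists, lowest degree first
-- (trailing zero coefficients are allowed and ignored).

Poly : Set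
Poly = List Bool

_+ₚ_ : Poly → Poly → Poly
[] +ₚ q = q
(a ∷ p) +ₚ [] = a ∷ p
(a ∷ p) +ₚ (b ∷ q) = (a xor b) ∷ (p +ₚ q)

xₚ* : Poly → Poly
xₚ* p = false ∷ p

scal : Bool → Poly → Poly
scal a p = map (a ∧_) p

_*ₚ_ : Poly → Poly → Poly
[] *ₚ q = []
(a ∷ p) *ₚ q = scal a q +ₚ xₚ* (p *ₚ q)

xpow : ℕ → Poly
xpow i = replicate i false ++ (true ∷ [])

-- degree (deg 0 := 0 by convention; only used for nonzero p)
degAux : ℕ → ℕ → Poly → ℕ
degAux i d [] = d
degAux i d (true ∷ p) = degAux (suc i) i p
degAux i d (false ∷ p) = degAux (suc i) d p

deg : Poly → ℕ
deg = degAux 0 0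

coeff : ℕ → Poly → Bool
coeff i [] = false
coeff zero (a ∷ p) = a
coeff (suc i) (a ∷ p) = coeff i p

-- Long division by p (p ≠ 0, leading coefficient 1 since over F₂),
-- processing the coefficients of the dividend from the highest degree down.
divStep : Poly → Bool → Poly × Poly → Poly × Poly
divStep p c (q , r) =
  let r' = c ∷ r
      b  = coeff (deg p) r'
  in (b ∷ q) , (if b then r' +ₚ p else r')

divModₚ : Poly → Poly → Poly × Poly
divModₚ a p = foldr (divStep p) ([] , []) a
-- foldr on the low-first list processes the highest coefficient first;
-- the quotient bits are emitted with the highest first and consed, so the
-- resulting list is low-first as well.

quotₚ : Poly → Poly → Poly
quotₚ a p = proj₁ (divModₚ a p)

evalAt2 : Poly → ℕ
evalAt2 [] = 0
evalAt2 (a ∷ p) = (if a then 1 else 0) ℕ.+ 2 ℕ.* evalAt2 p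

fib : ℕ → Poly
fib zero = []
fib (suc zero) = true ∷ []
fib (suc (suc n)) = xₚ* (fib (suc n)) +ₚ fib n

-- Writing a/p = Σ_{i≥w} t_i x^{-i},
-- the polynomial quotient of x^m·a by p is Σ_{i≤m} t_i x^{m-i}; reducing it
-- mod x^m keeps exactly the terms with 1 ≤ i ≤ m, and evaluating at x = 2
-- gives Σ_{i=max(w,1)}^m t_i 2^{m-i} = 2^m · ν_m(a/p).

νScaled : ℕ → Poly → Poly → ℕ
νScaled m a p = evalAt2 (take m (quotₚ (xpow m *ₚ a) p))

ν : ℕ → Poly → Poly → ℚ
ν m a p = (+ νScaled m a p) / (2 ^ m) where instance _ = ℕP.m^n≢0 2 m

digitsPoly : ℕ → ℕ → Poly
digitsPoly zero n = []
digitsPoly (suc m) n = (if (n % 2) ℕ.≡ᵇ 1 then true else false) ∷ digitsPoly m (n ℕ./ 2)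

Point : Set
Point = ℚ × ℚ

lpPoint : Poly → Poly → Poly → ℕ → Point
lpPoint p q₁ q₂ n =
  let m = deg p ; nx = digitsPoly m n
  in ν m (nx *ₚ q₁) p , ν m (nx *ₚ q₂) p

lpSet : Poly → Poly → Poly → List Point
lpSet p q₁ q₂ = map (lpPoint p q₁ q₂) (upTo (2 ^ deg p))

dist∞ : Point → Point → ℚ
dist∞ (a₁ , a₂) (b₁ , b₂) = ∣ a₁ - b₁ ∣ ⊔ ∣ a₂ - b₂ ∣

-- separation radius q_∞(Q) = min_{x ≠ y ∈ Q} ‖x - y‖_∞ / 2
-- (nothing if Q has fewer than two distinct points)

half : ℚ
half = + 1 / 2

pairDists : List Point → List ℚ
pairDists Q = concatMap (λ x → concatMap (λ y → f x y) Q) Q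
  where
  f : Point → Point → List ℚ
  f (a₁ , a₂) (b₁ , b₂) with a₁ ≟ b₁ | a₂ ≟ b₂
  ... | yes _ | yes _ = []
  ... | _ | _ = (half * dist∞ (a₁ , a₂) (b₁ , b₂)) ∷ []

minimum : List ℚ → Maybe ℚ
minimum [] = nothing
minimum (r ∷ rs) with minimum rs
... | nothing = just r
... | just s = just (r ⊓ s)

qInf : List Point → Maybe ℚ
qInf Q = minimum (pairDists Q)

_^ℚ_ : ℚ → ℕ → ℚ
r ^ℚ zero = 1ℚ
r ^ℚ suc n = r * (r ^ℚ n)

{-# OPTIONS --safe #-}
-- Over F₂ the Fibonacci polynomials satisfy f_{2n} = x f_n² and f_{2n+1} = f_n² + f_{n+1}², and squaring
-- is the substitution x ↦ x².  Hence p = f_{2^k} = x^m, so ν_m(a/p) is the integer with binary digits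
-- a_{m−1} … a_0 divided by 2^m; and with u = 2^{k−3}, w = u − 2 (so m = w + 7u + 1, m' = w + 1) the same
-- recursion gives f_m ≡ 1 + x^{4u} + x^{6u} + x^{7u} mod x^{7u+1}.  The indices are
-- n(x) = x^w (1 + x + ⋯ + x^{6u−1}) and n'(x) = x^w (1 + x^{6u}), and modulo x^m their products with f_m are
-- x^w (1 + ⋯ + x^{4u−1} + x^{7u}) and x^w (1 + x^{4u} + x^{7u}).  So in both coordinates x_{n'} exceeds x_n
-- by exactly 2^{w+1}/2^m = 2^{−(m−m')}, whence q_∞ ≤ 2^{−7u−1} and q_∞⁸ ≤ 2^{−8(7u+1)} = 2^{−15} N^{−7}.
module Submission where

open import Defs
open import Data.Bool as Bool using (Bool; true; false; _xor_; _∧_; not; if_then_else_)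
open import Data.Bool.Properties using (xor-identityʳ; xor-assoc; xor-same; ∧-zeroʳ; ∧-identityʳ; T-≡)
open import Data.Bool.Solver using (module xor-∧-Solver)
open import Data.Fin using (Fin; toℕ; fromℕ<)
open import Data.Fin.Properties using (toℕ-fromℕ<; all?)
open import Data.List using (List; []; _∷_; _++_; take; replicate; concatMap)
open import Data.List.Properties using (++-identityʳ)
open import Data.List.Membership.Propositional using (_∈_; lose)
open import Data.List.Membership.Propositional.Properties using (∈-map⁺; ∈-upTo⁺; ∈-concatMap⁺; ∈-concatMap⁻)
open import Data.List.Relation.Unary.Any using (here; there; satisfied)
open import Data.Maybe using (just)
open import Data.Empty using (⊥-elim)
open import Relation.Nullary using (yes; no)
open import Data.Nat as ℕ using (ℕ; zero; suc; _+_; _*_; _∸_; _^_; _≤_; _<_; _<ᵇ_; z≤n; s≤s)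
import Data.Nat.Properties as ℕ
open import Data.Nat.Properties using (m^n≢0; m*n≢0)
open import Data.Nat.DivMod using (m≡m%n+[m/n]*n; m%n<n; m*n%n≡0; m*n/n≡m; m<n*o⇒m/o<n; [m+kn]%n≡m%n; +-distrib-/)
open import Data.Nat.Tactic.RingSolver using (solve-∀)
open import Data.Integer as ℤ using (+_)
import Data.Integer.Properties as ℤ
open import Data.Rational using (ℚ; _/_; 0ℚ; 1ℚ; toℚᵘ)
import Data.Rational as ℚ
import Data.Rational.Properties as ℚ
open import Data.Rational.Unnormalised as ℚᵘ using (mkℚᵘ; *≡*)
import Data.Rational.Unnormalised.Properties as ℚᵘ
open import Data.Product using (_×_; _,_; proj₁; proj₂; ∃)
open import Function using (_∘_; _∋_)
open import Function.Bundles using (Equivalence)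
open import Relation.Nullary.Decidable using (from-yes)
open import Relation.Binary.PropositionalEquality
  using (_≡_; _≢_; _≗_; refl; sym; trans; cong; cong₂; cong-app; subst; subst₂; _→-setoid_; module ≡-Reasoning)
import Relation.Binary.Reasoning.Setoid as SetoidReasoning

open xor-∧-Solver using (_:=_; _:+_) renaming (solve to solveBool)

-- Power series over F₂

Series : Set
Series = ℕ → Bool

module ≗-Reasoning = SetoidReasoning (ℕ →-setoid Bool)

⟦_⟧ : Poly → Series
⟦ p ⟧ i = coeff i p

zeros : Series
zeros _ = false

one : Series
one zero    = true
one (suc _) = false

infixl 6 _⊕_
infixr 7 x·_ x^_·_

_⊕_ : Series → Series → Series
(f ⊕ g) i = f i xor g i

x·_ : Series → Series
(x· f) zero    = false
(x· f) (suc i) = f i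

x^_·_ : ℕ → Series → Series
x^ zero  · f = f
x^ suc e · f = x· x^ e · f

monomial : ℕ → Series
monomial e = x^ e · one

ones : ℕ → Series
ones c i = i <ᵇ c

onesMul : ℕ → Series → Series
onesMul zero    f = zeros
onesMul (suc c) f = f ⊕ x· onesMul c f

infix 4 _≈_mod-x^_
_≈_mod-x^_ : Series → Series → ℕ → Set
f ≈ g mod-x^ n = ∀ i → i < n → f i ≡ g i

⊕-cong : ∀ {f f′ g g′} → f ≗ f′ → g ≗ g′ → f ⊕ g ≗ f′ ⊕ g′
⊕-cong f≗f′ g≗g′ i = cong₂ _xor_ (f≗f′ i) (g≗g′ i)

⊕-congˡ : ∀ f {g g′} → g ≗ g′ → f ⊕ g ≗ f ⊕ g′
⊕-congˡ f g≗g′ i = cong (f i xor_) (g≗g′ i)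

⊕-congʳ : ∀ g {f f′} → f ≗ f′ → f ⊕ g ≗ f′ ⊕ g
⊕-congʳ g f≗f′ i = cong (_xor g i) (f≗f′ i)

⊕-identityʳ : ∀ f → f ⊕ zeros ≗ f
⊕-identityʳ f i = xor-identityʳ (f i)

f⊕g⊕f≗g : ∀ f g → f ⊕ g ⊕ f ≗ g
f⊕g⊕f≗g f g i = solveBool 2 (λ a b → a :+ b :+ a := b) refl (f i) (g i)

x·-cong : ∀ {f g} → f ≗ g → x· f ≗ x· g
x·-cong f≗g zero    = refl
x·-cong f≗g (suc i) = f≗g i

x·-⊕ : ∀ f g → x· (f ⊕ g) ≗ x· f ⊕ x· g
x·-⊕ f g zero    = refl
x·-⊕ f g (suc i) = refl

x·-zeros : x· zeros ≗ zeros
x·-zeros zero    = refl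
x·-zeros (suc i) = refl

x^-cong : ∀ e {f g} → f ≗ g → x^ e · f ≗ x^ e · g
x^-cong zero    f≗g = f≗g
x^-cong (suc e) f≗g = x·-cong (x^-cong e f≗g)

x^-⊕ : ∀ e f g → x^ e · (f ⊕ g) ≗ x^ e · f ⊕ x^ e · g
x^-⊕ zero    f g i = refl
x^-⊕ (suc e) f g i = trans (x·-cong (x^-⊕ e f g) i) (x·-⊕ (x^ e · f) (x^ e · g) i)

x^-zeros : ∀ e → x^ e · zeros ≗ zeros
x^-zeros zero    i = refl
x^-zeros (suc e) i = trans (x·-cong (x^-zeros e) i) (x·-zeros i)

x^-+ : ∀ a b f → x^ (a + b) · f ≡ x^ a · x^ b · f
x^-+ zero    b f = refl
x^-+ (suc a) b f = cong x·_ (x^-+ a b f)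

x^-x· : ∀ e f → x^ e · x· f ≡ x· x^ e · f
x^-x· zero    f = refl
x^-x· (suc e) f = cong x·_ (x^-x· e f)

x^-below : ∀ e f {i} → i < e → (x^ e · f) i ≡ false
x^-below (suc e) f {zero}  _         = refl
x^-below (suc e) f {suc i} (s≤s i<e) = x^-below e f i<e

x^-at : ∀ e f i → (x^ e · f) (e + i) ≡ f i
x^-at zero    f i = refl
x^-at (suc e) f i = x^-at e f i

monomial-cong : ∀ {a b} → a ≡ b → monomial a ≗ monomial b
monomial-cong a≡b i = cong (λ e → monomial e i) a≡b

<ᵇ-true : ∀ {m n} → m < n → (m <ᵇ n) ≡ true
<ᵇ-true m<n = Equivalence.to T-≡ (ℕ.<⇒<ᵇ m<n)

x^-ones-below : ∀ e c {j} → j < e + c → (x^ e · ones c) j ≡ not (j <ᵇ e)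
x^-ones-below zero    c         j<c          = <ᵇ-true j<c
x^-ones-below (suc e) c {zero}  _            = refl
x^-ones-below (suc e) c {suc j} (s≤s j<e+c) = x^-ones-below e c j<e+c

monomial-≤ : ∀ e {j} → j ≤ e → monomial e j ≡ not (j <ᵇ e)
monomial-≤ zero    {zero}  _         = refl
monomial-≤ (suc e) {zero}  _         = refl
monomial-≤ (suc e) {suc j} (s≤s j≤e) = monomial-≤ e j≤e

monomial-above : ∀ e {j} → e < j → monomial e j ≡ false
monomial-above zero    {suc j} _         = refl
monomial-above (suc e) {suc j} (s≤s e<j) = monomial-above e e<j

ones-above : ∀ c {j} → c ≤ j → ones c j ≡ false
ones-above zero    _         = refl
ones-above (suc c) (s≤s c≤j) = ones-above c c≤j

ones-suc : ∀ c → ones (suc c) ≗ one ⊕ x· ones c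
ones-suc c zero    = refl
ones-suc c (suc i) = refl

onesMul-⊕ : ∀ c f g → onesMul c (f ⊕ g) ≗ onesMul c f ⊕ onesMul c g
onesMul-⊕ zero    f g i = refl
onesMul-⊕ (suc c) f g i = begin
  (f i xor g i) xor (x· onesMul c (f ⊕ g)) i
    ≡⟨ cong ((f i xor g i) xor_) (trans (x·-cong (onesMul-⊕ c f g) i) (x·-⊕ (onesMul c f) (onesMul c g) i)) ⟩
  (f i xor g i) xor ((x· onesMul c f) i xor (x· onesMul c g) i)
    ≡⟨ solveBool 4 (λ a b c d → (a :+ b) :+ (c :+ d) := (a :+ c) :+ (b :+ d)) refl (f i) (g i) _ _ ⟩
  (f i xor (x· onesMul c f) i) xor (g i xor (x· onesMul c g) i) ∎
  where open ≡-Reasoning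

onesMul-monomial : ∀ c e → onesMul c (monomial e) ≗ x^ e · ones c
onesMul-monomial zero    e i = sym (x^-zeros e i)
onesMul-monomial (suc c) e = begin
  monomial e ⊕ x· onesMul c (monomial e)   ≈⟨ ⊕-congˡ (monomial e) (x·-cong (onesMul-monomial c e)) ⟩
  x^ e · one ⊕ x· x^ e · ones c            ≈⟨ ⊕-congˡ (monomial e) (cong-app (x^-x· e (ones c))) ⟨
  x^ e · one ⊕ x^ e · x· ones c            ≈⟨ x^-⊕ e one (x· ones c) ⟨
  x^ e · (one ⊕ x· ones c)                 ≈⟨ x^-cong e (ones-suc c) ⟨
  x^ e · ones (suc c)                      ∎
  where open ≗-Reasoning

mod-trans : ∀ {f g h} n → f ≈ g mod-x^ n → g ≈ h mod-x^ n → f ≈ h mod-x^ n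
mod-trans n f≈g g≈h i i<n = trans (f≈g i i<n) (g≈h i i<n)

⊕-mod : ∀ {f f′ g g′} n → f ≈ f′ mod-x^ n → g ≈ g′ mod-x^ n → f ⊕ g ≈ f′ ⊕ g′ mod-x^ n
⊕-mod n f≈f′ g≈g′ i i<n = cong₂ _xor_ (f≈f′ i i<n) (g≈g′ i i<n)

x^-mod : ∀ e {f g} n → f ≈ g mod-x^ n → x^ e · f ≈ x^ e · g mod-x^ n
x^-mod zero    n f≈g = f≈g
x^-mod (suc e) n f≈g zero    _   = refl
x^-mod (suc e) n f≈g (suc i) i<n = x^-mod e n f≈g i (ℕ.<-trans (ℕ.n<1+n i) i<n)

onesMul-mod : ∀ c {f g} n → f ≈ g mod-x^ n → onesMul c f ≈ onesMul c g mod-x^ n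
onesMul-mod zero    n f≈g i i<n = refl
onesMul-mod (suc c) n f≈g i i<n = cong₂ _xor_ (f≈g i i<n) (x^-mod 1 n (onesMul-mod c n f≈g) i i<n)

⟦⟧-+ₚ : ∀ p q → ⟦ p +ₚ q ⟧ ≗ ⟦ p ⟧ ⊕ ⟦ q ⟧
⟦⟧-+ₚ []      q       i       = refl
⟦⟧-+ₚ (a ∷ p) []      zero    = sym (xor-identityʳ a)
⟦⟧-+ₚ (a ∷ p) []      (suc i) = sym (xor-identityʳ _)
⟦⟧-+ₚ (a ∷ p) (b ∷ q) zero    = refl
⟦⟧-+ₚ (a ∷ p) (b ∷ q) (suc i) = ⟦⟧-+ₚ p q i

⟦⟧-xₚ* : ∀ p → ⟦ xₚ* p ⟧ ≗ x· ⟦ p ⟧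
⟦⟧-xₚ* p zero    = refl
⟦⟧-xₚ* p (suc i) = refl

⟦⟧-scal : ∀ a q i → ⟦ scal a q ⟧ i ≡ a ∧ ⟦ q ⟧ i
⟦⟧-scal a []      i       = sym (∧-zeroʳ a)
⟦⟧-scal a (b ∷ q) zero    = refl
⟦⟧-scal a (b ∷ q) (suc i) = ⟦⟧-scal a q i

⟦⟧-∷*ₚ : ∀ a p q i → ⟦ (a ∷ p) *ₚ q ⟧ i ≡ (a ∧ ⟦ q ⟧ i) xor (x· ⟦ p *ₚ q ⟧) i
⟦⟧-∷*ₚ a p q i = trans (⟦⟧-+ₚ (scal a q) (xₚ* (p *ₚ q)) i)
                       (cong₂ _xor_ (⟦⟧-scal a q i) (⟦⟧-xₚ* (p *ₚ q) i))

⟦⟧-false∷*ₚ : ∀ p q → ⟦ (false ∷ p) *ₚ q ⟧ ≗ x· ⟦ p *ₚ q ⟧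
⟦⟧-false∷*ₚ = ⟦⟧-∷*ₚ false

⟦⟧-true∷*ₚ : ∀ p q → ⟦ (true ∷ p) *ₚ q ⟧ ≗ ⟦ q ⟧ ⊕ x· ⟦ p *ₚ q ⟧
⟦⟧-true∷*ₚ = ⟦⟧-∷*ₚ true

⟦⟧-*ₚ-1 : ∀ p → ⟦ p *ₚ (true ∷ []) ⟧ ≗ ⟦ p ⟧
⟦⟧-*ₚ-1 []      i       = refl
⟦⟧-*ₚ-1 (a ∷ p) zero    = trans (⟦⟧-∷*ₚ a p (true ∷ []) zero)
                                (trans (xor-identityʳ _) (∧-identityʳ a))
⟦⟧-*ₚ-1 (a ∷ p) (suc i) = trans (⟦⟧-∷*ₚ a p (true ∷ []) (suc i))
                                (trans (cong (_xor ⟦ p *ₚ (true ∷ []) ⟧ i) (∧-zeroʳ a)) (⟦⟧-*ₚ-1 p i))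

⟦⟧-replicate-false-*ₚ : ∀ b L q → ⟦ (replicate b false ++ L) *ₚ q ⟧ ≗ x^ b · ⟦ L *ₚ q ⟧
⟦⟧-replicate-false-*ₚ zero    L q i = refl
⟦⟧-replicate-false-*ₚ (suc b) L q i =
  trans (⟦⟧-false∷*ₚ (replicate b false ++ L) q i) (x·-cong (⟦⟧-replicate-false-*ₚ b L q) i)

⟦⟧-replicate-false*ₚ : ∀ b q → ⟦ replicate b false *ₚ q ⟧ ≗ zeros
⟦⟧-replicate-false*ₚ b q i = begin
  ⟦ replicate b false *ₚ q ⟧ i         ≡⟨ cong (λ L → ⟦ L *ₚ q ⟧ i) (sym (++-identityʳ (replicate b false))) ⟩
  ⟦ (replicate b false ++ []) *ₚ q ⟧ i ≡⟨ ⟦⟧-replicate-false-*ₚ b [] q i ⟩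
  (x^ b · zeros) i                     ≡⟨ x^-zeros b i ⟩
  false                                ∎
  where open ≡-Reasoning

⟦⟧-replicate-true-*ₚ : ∀ c L q → ⟦ (replicate c true ++ L) *ₚ q ⟧ ≗ onesMul c ⟦ q ⟧ ⊕ x^ c · ⟦ L *ₚ q ⟧
⟦⟧-replicate-true-*ₚ zero    L q i = refl
⟦⟧-replicate-true-*ₚ (suc c) L q = begin
  ⟦ (true ∷ replicate c true ++ L) *ₚ q ⟧                   ≈⟨ ⟦⟧-true∷*ₚ (replicate c true ++ L) q ⟩
  ⟦ q ⟧ ⊕ x· ⟦ (replicate c true ++ L) *ₚ q ⟧               ≈⟨ ⊕-congˡ ⟦ q ⟧ (x·-cong (⟦⟧-replicate-true-*ₚ c L q)) ⟩
  ⟦ q ⟧ ⊕ x· (onesMul c ⟦ q ⟧ ⊕ x^ c · ⟦ L *ₚ q ⟧)           ≈⟨ ⊕-congˡ ⟦ q ⟧ (x·-⊕ (onesMul c ⟦ q ⟧) _) ⟩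
  ⟦ q ⟧ ⊕ (x· onesMul c ⟦ q ⟧ ⊕ x· x^ c · ⟦ L *ₚ q ⟧)        ≈⟨ (λ i → sym (xor-assoc (⟦ q ⟧ i) _ _)) ⟩
  onesMul (suc c) ⟦ q ⟧ ⊕ x^ suc c · ⟦ L *ₚ q ⟧             ∎
  where open ≗-Reasoning

⟦⟧-xᶜ*ₚ : ∀ c r q → ⟦ (replicate c false ++ true ∷ replicate r false) *ₚ q ⟧ ≗ x^ c · ⟦ q ⟧
⟦⟧-xᶜ*ₚ c r q = begin
  ⟦ (replicate c false ++ true ∷ replicate r false) *ₚ q ⟧
    ≈⟨ ⟦⟧-replicate-false-*ₚ c (true ∷ replicate r false) q ⟩
  x^ c · ⟦ (true ∷ replicate r false) *ₚ q ⟧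
    ≈⟨ x^-cong c (⟦⟧-true∷*ₚ (replicate r false) q) ⟩
  x^ c · (⟦ q ⟧ ⊕ x· ⟦ replicate r false *ₚ q ⟧)
    ≈⟨ x^-cong c (⊕-congˡ ⟦ q ⟧ (x·-cong (⟦⟧-replicate-false*ₚ r q))) ⟩
  x^ c · (⟦ q ⟧ ⊕ x· zeros)
    ≈⟨ x^-cong c (⊕-congˡ ⟦ q ⟧ x·-zeros) ⟩
  x^ c · (⟦ q ⟧ ⊕ zeros)
    ≈⟨ x^-cong c (⊕-identityʳ ⟦ q ⟧) ⟩
  x^ c · ⟦ q ⟧ ∎
  where open ≗-Reasoning

⟦⟧-xpow*ₚ : ∀ m q → ⟦ xpow m *ₚ q ⟧ ≗ x^ m · ⟦ q ⟧
⟦⟧-xpow*ₚ m = ⟦⟧-xᶜ*ₚ m 0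

⟦⟧-ones*ₚ : ∀ c r q → ⟦ (replicate c true ++ replicate r false) *ₚ q ⟧ ≗ onesMul c ⟦ q ⟧
⟦⟧-ones*ₚ c r q = begin
  ⟦ (replicate c true ++ replicate r false) *ₚ q ⟧
    ≈⟨ ⟦⟧-replicate-true-*ₚ c (replicate r false) q ⟩
  onesMul c ⟦ q ⟧ ⊕ x^ c · ⟦ replicate r false *ₚ q ⟧
    ≈⟨ ⊕-congˡ (onesMul c ⟦ q ⟧) (x^-cong c (⟦⟧-replicate-false*ₚ r q)) ⟩
  onesMul c ⟦ q ⟧ ⊕ x^ c · zeros
    ≈⟨ ⊕-congˡ (onesMul c ⟦ q ⟧) (x^-zeros c) ⟩
  onesMul c ⟦ q ⟧ ⊕ zeros
    ≈⟨ ⊕-identityʳ (onesMul c ⟦ q ⟧) ⟩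
  onesMul c ⟦ q ⟧ ∎
  where open ≗-Reasoning

⟦⟧-1+x¹⁺ᶜ*ₚ : ∀ c r q → ⟦ (true ∷ replicate c false ++ true ∷ replicate r false) *ₚ q ⟧ ≗ ⟦ q ⟧ ⊕ x^ suc c · ⟦ q ⟧
⟦⟧-1+x¹⁺ᶜ*ₚ c r q i = trans (⟦⟧-true∷*ₚ (replicate c false ++ true ∷ replicate r false) q i)
                            (⊕-congˡ ⟦ q ⟧ (x·-cong (⟦⟧-xᶜ*ₚ c r q)) i)

bit : Bool → ℕ
bit b = if b then 1 else 0

eval₂ : ℕ → Series → ℕ
eval₂ zero    f = 0
eval₂ (suc m) f = bit (f 0) + 2 * eval₂ m (f ∘ suc)

eval₂-cong : ∀ m {f g} → f ≈ g mod-x^ m → eval₂ m f ≡ eval₂ m g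
eval₂-cong zero    f≈g = refl
eval₂-cong (suc m) f≈g =
  cong₂ (λ b v → bit b + 2 * v) (f≈g 0 (s≤s z≤n)) (eval₂-cong m (λ i i<m → f≈g (suc i) (s≤s i<m)))

eval₂-zeros : ∀ m → eval₂ m zeros ≡ 0
eval₂-zeros zero    = refl
eval₂-zeros (suc m) = cong (2 *_) (eval₂-zeros m)

evalAt2-take : ∀ m q → evalAt2 (take m q) ≡ eval₂ m ⟦ q ⟧
evalAt2-take zero    q       = refl
evalAt2-take (suc m) []      = sym (cong (2 *_) (eval₂-zeros m))
evalAt2-take (suc m) (a ∷ q) = cong (λ v → bit a + 2 * v) (evalAt2-take m q)

eval₂-x^ : ∀ w K f → eval₂ (w + K) (x^ w · f) ≡ 2 ^ w * eval₂ K f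
eval₂-x^ zero    K f = sym (ℕ.+-identityʳ _)
eval₂-x^ (suc w) K f = trans (cong (2 *_) (eval₂-x^ w K f)) (sym (ℕ.*-assoc 2 (2 ^ w) _))

eval₂-⊕-monomial : ∀ m j f → j < m → f j ≡ false → eval₂ m (f ⊕ monomial j) ≡ eval₂ m f + 2 ^ j
eval₂-⊕-monomial (suc m) zero    f _         f₀≡false = begin
  bit (f 0 xor true) + 2 * eval₂ m (λ i → f (suc i) xor false)
    ≡⟨ cong₂ (λ b v → bit (b xor true) + 2 * v) f₀≡false (eval₂-cong m (λ i _ → xor-identityʳ (f (suc i)))) ⟩
  1 + 2 * eval₂ m (f ∘ suc)
    ≡⟨ ℕ.+-comm 1 _ ⟩
  2 * eval₂ m (f ∘ suc) + 1
    ≡⟨ cong (λ b → bit b + 2 * eval₂ m (f ∘ suc) + 1) f₀≡false ⟨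
  bit (f 0) + 2 * eval₂ m (f ∘ suc) + 1 ∎
  where open ≡-Reasoning
eval₂-⊕-monomial (suc m) (suc j) f (s≤s j<m) fⱼ≡false = begin
  bit (f 0 xor false) + 2 * eval₂ m ((f ∘ suc) ⊕ monomial j)
    ≡⟨ cong₂ (λ b v → bit b + 2 * v) (xor-identityʳ (f 0)) (eval₂-⊕-monomial m j (f ∘ suc) j<m fⱼ≡false) ⟩
  bit (f 0) + 2 * (eval₂ m (f ∘ suc) + 2 ^ j)
    ≡⟨ regroup (bit (f 0)) (eval₂ m (f ∘ suc)) (2 ^ j) ⟩
  bit (f 0) + 2 * eval₂ m (f ∘ suc) + 2 * 2 ^ j ∎
  where
  open ≡-Reasoning
  regroup : ∀ a b c → a + 2 * (b + c) ≡ a + 2 * b + 2 * c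
  regroup = solve-∀

eval₂-ones : ∀ c m → c ≤ m → eval₂ m (ones c) + 1 ≡ 2 ^ c
eval₂-ones zero    m       _         = cong (_+ 1) (eval₂-zeros m)
eval₂-ones (suc c) (suc m) (s≤s c≤m) = trans (regroup (eval₂ m (ones c))) (cong (2 *_) (eval₂-ones c m c≤m))
  where
  regroup : ∀ e → 1 + 2 * e + 1 ≡ 2 * (e + 1)
  regroup = solve-∀

eval₂-one : ∀ m → eval₂ (suc m) one ≡ 1
eval₂-one m = cong (1 ℕ.+_) (cong (2 *_) (eval₂-zeros m))

-- Degree of, and division by, a monomial

degAux-zeros : ∀ p i d → ⟦ p ⟧ ≗ zeros → degAux i d p ≡ d
degAux-zeros []          i d p≗0 = refl
degAux-zeros (true ∷ p)  i d p≗0 with p≗0 zero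
... | ()
degAux-zeros (false ∷ p) i d p≗0 = degAux-zeros p (suc i) d (p≗0 ∘ suc)

degAux-monomial : ∀ p e i d → ⟦ p ⟧ ≗ monomial e → degAux i d p ≡ i + e
degAux-monomial []          e       i d p≗xᵉ with trans (p≗xᵉ (e + 0)) (x^-at e one 0)
... | ()
degAux-monomial (true ∷ p)  zero    i d p≗xᵉ =
  trans (degAux-zeros p (suc i) i (p≗xᵉ ∘ suc)) (sym (ℕ.+-identityʳ i))
degAux-monomial (true ∷ p)  (suc e) i d p≗xᵉ with p≗xᵉ zero
... | ()
degAux-monomial (false ∷ p) zero    i d p≗xᵉ with p≗xᵉ zero
... | ()
degAux-monomial (false ∷ p) (suc e) i d p≗xᵉ =
  trans (degAux-monomial p e (suc i) d (p≗xᵉ ∘ suc)) (sym (ℕ.+-suc i e))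

deg-monomial : ∀ p e → ⟦ p ⟧ ≗ monomial e → deg p ≡ e
deg-monomial p e = degAux-monomial p e 0 0

truncate : ℕ → Series → Series
truncate m f i = (i <ᵇ m) ∧ f i

truncate-suc : ∀ d f j → truncate (suc d) f j xor (f d ∧ monomial d j) ≡ truncate d f j
truncate-suc zero    f zero    = trans (cong (f 0 xor_) (∧-identityʳ (f 0))) (xor-same (f 0))
truncate-suc (suc d) f zero    = trans (cong (f 0 xor_) (∧-zeroʳ _)) (xor-identityʳ _)
truncate-suc zero    f (suc j) = ∧-zeroʳ _
truncate-suc (suc d) f (suc j) = truncate-suc d (f ∘ suc) j

module DivisionByMonomial (d : ℕ) (p : Poly) (p≗xᵈ⁺¹ : ⟦ p ⟧ ≗ monomial (suc d)) where

  remainder : Poly → Poly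
  remainder a = proj₂ (divModₚ a p)

  quotient : Poly → Poly
  quotient a = proj₁ (divModₚ a p)

  reduce : ∀ b r i → ⟦ if b then r +ₚ p else r ⟧ i ≡ ⟦ r ⟧ i xor (b ∧ monomial (suc d) i)
  reduce true  r i = trans (⟦⟧-+ₚ r p i) (cong (⟦ r ⟧ i xor_) (p≗xᵈ⁺¹ i))
  reduce false r i = sym (xor-identityʳ _)

  remainder-spec : ∀ a → ⟦ remainder a ⟧ ≗ truncate (suc d) ⟦ a ⟧

  leading-bit : ∀ c a → coeff (deg p) (c ∷ remainder a) ≡ ⟦ a ⟧ d
  leading-bit c a = begin
    coeff (deg p) (c ∷ remainder a)  ≡⟨ cong (λ e → coeff e (c ∷ remainder a)) (deg-monomial p (suc d) p≗xᵈ⁺¹) ⟩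
    ⟦ remainder a ⟧ d                ≡⟨ remainder-spec a d ⟩
    (d <ᵇ suc d) ∧ ⟦ a ⟧ d           ≡⟨ cong (_∧ ⟦ a ⟧ d) (<ᵇ-true (ℕ.n<1+n d)) ⟩
    ⟦ a ⟧ d                          ∎
    where open ≡-Reasoning

  remainder-spec []      i       = sym (∧-zeroʳ _)
  remainder-spec (c ∷ a) zero    =
    trans (reduce (coeff (deg p) (c ∷ remainder a)) (c ∷ remainder a) zero)
          (trans (cong (c xor_) (∧-zeroʳ _)) (xor-identityʳ c))
  remainder-spec (c ∷ a) (suc j) = begin
    ⟦ remainder (c ∷ a) ⟧ (suc j)
      ≡⟨ reduce (coeff (deg p) (c ∷ remainder a)) (c ∷ remainder a) (suc j) ⟩
    ⟦ remainder a ⟧ j xor (coeff (deg p) (c ∷ remainder a) ∧ monomial d j)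
      ≡⟨ cong₂ (λ r b → r xor (b ∧ monomial d j)) (remainder-spec a j) (leading-bit c a) ⟩
    truncate (suc d) ⟦ a ⟧ j xor (⟦ a ⟧ d ∧ monomial d j)
      ≡⟨ truncate-suc d ⟦ a ⟧ j ⟩
    truncate d ⟦ a ⟧ j
      ∎
    where open ≡-Reasoning

  quotient-spec : ∀ a i → ⟦ quotient a ⟧ i ≡ ⟦ a ⟧ (i + suc d)
  quotient-spec []      i       = refl
  quotient-spec (c ∷ a) zero    = leading-bit c a
  quotient-spec (c ∷ a) (suc i) = quotient-spec a i

νScaled-monomial : ∀ M p → ⟦ p ⟧ ≗ monomial M → ∀ a → νScaled M a p ≡ eval₂ M ⟦ a ⟧
νScaled-monomial zero    p p≗xᴹ a = refl
νScaled-monomial (suc d) p p≗xᴹ a =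
  trans (evalAt2-take (suc d) (quotient (xpow (suc d) *ₚ a)))
        (eval₂-cong (suc d) (λ i _ → quotient-of-shift i))
  where
  open DivisionByMonomial d p p≗xᴹ
  quotient-of-shift : ∀ i → ⟦ quotient (xpow (suc d) *ₚ a) ⟧ i ≡ ⟦ a ⟧ i
  quotient-of-shift i = begin
    ⟦ quotient (xpow (suc d) *ₚ a) ⟧ i  ≡⟨ quotient-spec (xpow (suc d) *ₚ a) i ⟩
    ⟦ xpow (suc d) *ₚ a ⟧ (i + suc d)   ≡⟨ ⟦⟧-xpow*ₚ (suc d) a (i + suc d) ⟩
    (x^ suc d · ⟦ a ⟧) (i + suc d)      ≡⟨ cong (x^ suc d · ⟦ a ⟧) (ℕ.+-comm i (suc d)) ⟩
    (x^ suc d · ⟦ a ⟧) (suc d + i)      ≡⟨ x^-at (suc d) ⟦ a ⟧ i ⟩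
    ⟦ a ⟧ i                             ∎
    where open ≡-Reasoning

bit-of : ∀ r → r < 2 → bit (if r ℕ.≡ᵇ 1 then true else false) ≡ r
bit-of 0 _ = refl
bit-of 1 _ = refl
bit-of (suc (suc r)) (s≤s (s≤s ()))

eval₂-digitsPoly : ∀ m n → n < 2 ^ m → eval₂ m ⟦ digitsPoly m n ⟧ ≡ n
eval₂-digitsPoly zero    zero    _      = refl
eval₂-digitsPoly zero    (suc n) (s≤s ())
eval₂-digitsPoly (suc m) n       n<2ᵐ⁺¹ = begin
  bit (if n ℕ.% 2 ℕ.≡ᵇ 1 then true else false) + 2 * eval₂ m ⟦ digitsPoly m (n ℕ./ 2) ⟧
    ≡⟨ cong₂ (λ b v → b + 2 * v) (bit-of (n ℕ.% 2) (m%n<n n 2)) (eval₂-digitsPoly m (n ℕ./ 2) n/2<2ᵐ) ⟩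
  n ℕ.% 2 + 2 * (n ℕ./ 2)
    ≡⟨ cong (n ℕ.% 2 ℕ.+_) (ℕ.*-comm 2 (n ℕ./ 2)) ⟩
  n ℕ.% 2 + n ℕ./ 2 * 2
    ≡⟨ m≡m%n+[m/n]*n n 2 ⟨
  n ∎
  where
  open ≡-Reasoning
  n/2<2ᵐ : n ℕ./ 2 < 2 ^ m
  n/2<2ᵐ = m<n*o⇒m/o<n (subst (n <_) (ℕ.*-comm 2 (2 ^ m)) n<2ᵐ⁺¹)

digitsPoly-2* : ∀ m y → digitsPoly (suc m) (2 * y) ≡ false ∷ digitsPoly m y
digitsPoly-2* m y = cong₂ (λ r q → (if r ℕ.≡ᵇ 1 then true else false) ∷ digitsPoly m q) [2y]%2≡0 [2y]/2≡y
  where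
  [2y]%2≡0 : (2 * y) ℕ.% 2 ≡ 0
  [2y]%2≡0 = trans (cong (ℕ._% 2) (ℕ.*-comm 2 y)) (m*n%n≡0 y 2)
  [2y]/2≡y : (2 * y) ℕ./ 2 ≡ y
  [2y]/2≡y = trans (cong (ℕ._/ 2) (ℕ.*-comm 2 y)) (m*n/n≡m y 2)

digitsPoly-1+2* : ∀ m y → digitsPoly (suc m) (1 + 2 * y) ≡ true ∷ digitsPoly m y
digitsPoly-1+2* m y = cong₂ (λ r q → (if r ℕ.≡ᵇ 1 then true else false) ∷ digitsPoly m q) [1+2y]%2≡1 [1+2y]/2≡y
  where
  1+2y≡1+y*2 : 1 + 2 * y ≡ 1 + y * 2
  1+2y≡1+y*2 = cong (1 ℕ.+_) (ℕ.*-comm 2 y)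
  [1+2y]%2≡1 : (1 + 2 * y) ℕ.% 2 ≡ 1
  [1+2y]%2≡1 = trans (cong (ℕ._% 2) 1+2y≡1+y*2) ([m+kn]%n≡m%n 1 y 2)
  [1+2y]/2≡y : (1 + 2 * y) ℕ./ 2 ≡ y
  [1+2y]/2≡y = trans (cong (ℕ._/ 2) 1+2y≡1+y*2) (trans (+-distrib-/ 1 (y * 2) 1%2+[y*2]%2<2) (cong (0 ℕ.+_) (m*n/n≡m y 2)))
    where
    1%2+[y*2]%2<2 : 1 ℕ.% 2 + (y * 2) ℕ.% 2 < 2
    1%2+[y*2]%2<2 = subst (λ z → 1 + z < 2) (sym (m*n%n≡0 y 2)) (s≤s (s≤s z≤n))

digitsPoly-0 : ∀ r → digitsPoly r 0 ≡ replicate r false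
digitsPoly-0 zero    = refl
digitsPoly-0 (suc r) = cong (false ∷_) (digitsPoly-0 r)

digitsPoly-2^* : ∀ b m y → digitsPoly (b + m) (2 ^ b * y) ≡ replicate b false ++ digitsPoly m y
digitsPoly-2^* zero    m y = cong (digitsPoly m) (ℕ.+-identityʳ y)
digitsPoly-2^* (suc b) m y = begin
  digitsPoly (suc (b + m)) (2 * 2 ^ b * y)    ≡⟨ cong (digitsPoly (suc (b + m))) (ℕ.*-assoc 2 (2 ^ b) y) ⟩
  digitsPoly (suc (b + m)) (2 * (2 ^ b * y))  ≡⟨ digitsPoly-2* (b + m) (2 ^ b * y) ⟩
  false ∷ digitsPoly (b + m) (2 ^ b * y)      ≡⟨ cong (false ∷_) (digitsPoly-2^* b m y) ⟩
  false ∷ replicate b false ++ digitsPoly m y ∎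
  where open ≡-Reasoning

2^[1+c]∸1 : ∀ c → 2 ^ suc c ∸ 1 ≡ 1 + 2 * (2 ^ c ∸ 1)
2^[1+c]∸1 c = begin
  2 * 2 ^ c ∸ 1               ≡⟨ cong (λ z → 2 * z ∸ 1) (ℕ.m∸n+n≡m (ℕ.m^n>0 2 c)) ⟨
  2 * (2 ^ c ∸ 1 + 1) ∸ 1     ≡⟨ cong (_∸ 1) (2[z+1]≡2+2z (2 ^ c ∸ 1)) ⟩
  1 + 2 * (2 ^ c ∸ 1)         ∎
  where
  open ≡-Reasoning
  2[z+1]≡2+2z : ∀ z → 2 * (z + 1) ≡ 2 + 2 * z
  2[z+1]≡2+2z = solve-∀

digitsPoly-2^∸1 : ∀ c r → digitsPoly (c + r) (2 ^ c ∸ 1) ≡ replicate c true ++ replicate r false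
digitsPoly-2^∸1 zero    r = digitsPoly-0 r
digitsPoly-2^∸1 (suc c) r = begin
  digitsPoly (suc (c + r)) (2 ^ suc c ∸ 1)       ≡⟨ cong (digitsPoly (suc (c + r))) (2^[1+c]∸1 c) ⟩
  digitsPoly (suc (c + r)) (1 + 2 * (2 ^ c ∸ 1)) ≡⟨ digitsPoly-1+2* (c + r) (2 ^ c ∸ 1) ⟩
  true ∷ digitsPoly (c + r) (2 ^ c ∸ 1)          ≡⟨ cong (true ∷_) (digitsPoly-2^∸1 c r) ⟩
  true ∷ replicate c true ++ replicate r false   ∎
  where open ≡-Reasoning

digitsPoly-1+2^[1+c] : ∀ c r →
  digitsPoly (suc (c + suc r)) (1 + 2 ^ suc c) ≡ true ∷ replicate c false ++ true ∷ replicate r false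
digitsPoly-1+2^[1+c] c r = begin
  digitsPoly (suc (c + suc r)) (1 + 2 * 2 ^ c)
    ≡⟨ digitsPoly-1+2* (c + suc r) (2 ^ c) ⟩
  true ∷ digitsPoly (c + suc r) (2 ^ c)
    ≡⟨ cong (λ y → true ∷ digitsPoly (c + suc r) y) (ℕ.*-identityʳ (2 ^ c)) ⟨
  true ∷ digitsPoly (c + suc r) (2 ^ c * 1)
    ≡⟨ cong (true ∷_) (digitsPoly-2^* c (suc r) 1) ⟩
  true ∷ replicate c false ++ digitsPoly (suc r) 1
    ≡⟨ cong (λ L → true ∷ replicate c false ++ true ∷ L) (digitsPoly-0 r) ⟩
  true ∷ replicate c false ++ true ∷ replicate r false ∎
  where open ≡-Reasoning

⟦digitsPoly-2^*⟧ : ∀ w m y q → ⟦ digitsPoly (w + m) (2 ^ w * y) *ₚ q ⟧ ≗ x^ w · ⟦ digitsPoly m y *ₚ q ⟧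
⟦digitsPoly-2^*⟧ w m y q i =
  trans (cong (λ L → ⟦ L *ₚ q ⟧ i) (digitsPoly-2^* w m y)) (⟦⟧-replicate-false-*ₚ w (digitsPoly m y) q i)

-- Fibonacci polynomials

dilate : Series → Series
dilate f zero          = f zero
dilate f (suc zero)    = false
dilate f (suc (suc i)) = dilate (f ∘ suc) i

dilate-cong : ∀ {f g} → f ≗ g → dilate f ≗ dilate g
dilate-cong f≗g zero          = f≗g zero
dilate-cong f≗g (suc zero)    = refl
dilate-cong f≗g (suc (suc i)) = dilate-cong (f≗g ∘ suc) i

dilate-mod : ∀ {f g} n → f ≈ g mod-x^ n → dilate f ≈ dilate g mod-x^ (2 * n)
dilate-mod (suc n) f≈g zero          _ = f≈g zero (s≤s z≤n)
dilate-mod (suc n) f≈g (suc zero)    _ = refl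
dilate-mod (suc n) f≈g (suc (suc i)) i+2<2n+2 =
  dilate-mod n (λ j j<n → f≈g (suc j) (s≤s j<n)) i
    (ℕ.≤-pred (ℕ.≤-pred (subst (suc (suc (suc i)) ≤_) (ℕ.*-suc 2 n) i+2<2n+2)))

dilate-⊕ : ∀ f g → dilate (f ⊕ g) ≗ dilate f ⊕ dilate g
dilate-⊕ f g zero          = refl
dilate-⊕ f g (suc zero)    = refl
dilate-⊕ f g (suc (suc i)) = dilate-⊕ (f ∘ suc) (g ∘ suc) i

dilate-zeros : dilate zeros ≗ zeros
dilate-zeros zero          = refl
dilate-zeros (suc zero)    = refl
dilate-zeros (suc (suc i)) = dilate-zeros i

dilate-x· : ∀ f → dilate (x· f) ≗ x· x· dilate f
dilate-x· f zero          = refl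
dilate-x· f (suc zero)    = refl
dilate-x· f (suc (suc i)) = refl

dilate-one : dilate one ≗ one
dilate-one zero          = refl
dilate-one (suc zero)    = refl
dilate-one (suc (suc i)) = dilate-zeros i

dilate-monomial : ∀ e → dilate (monomial e) ≗ monomial (2 * e)
dilate-monomial zero    = dilate-one
dilate-monomial (suc e) = begin
  dilate (x· monomial e)       ≈⟨ dilate-x· (monomial e) ⟩
  x· x· dilate (monomial e)    ≈⟨ x·-cong (x·-cong (dilate-monomial e)) ⟩
  monomial (2 + 2 * e)         ≈⟨ monomial-cong (ℕ.*-suc 2 e) ⟨
  monomial (2 * suc e)         ∎
  where open ≗-Reasoning

⟦fib⟧-cong : ∀ {m n} → m ≡ n → ⟦ fib m ⟧ ≗ ⟦ fib n ⟧
⟦fib⟧-cong m≡n i = cong (λ k → ⟦ fib k ⟧ i) m≡n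

⟦fib1⟧ : ⟦ fib 1 ⟧ ≗ one
⟦fib1⟧ zero    = refl
⟦fib1⟧ (suc i) = refl

⟦fib⟧-step : ∀ n → ⟦ fib (2 + n) ⟧ ≗ x· ⟦ fib (1 + n) ⟧ ⊕ ⟦ fib n ⟧
⟦fib⟧-step n i = trans (⟦⟧-+ₚ (xₚ* (fib (suc n))) (fib n) i)
                       (cong (_xor ⟦ fib n ⟧ i) (⟦⟧-xₚ* (fib (suc n)) i))

-- Over F₂ squaring is dilation, so these say f_{2n} = x f_n² and f_{2n+1} = f_n² + f_{n+1}².
fib-even : ∀ n → ⟦ fib (2 * n) ⟧ ≗ x· dilate ⟦ fib n ⟧
fib-odd  : ∀ n → ⟦ fib (1 + 2 * n) ⟧ ≗ dilate ⟦ fib n ⟧ ⊕ dilate ⟦ fib (1 + n) ⟧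

fib-even zero    zero    = refl
fib-even zero    (suc i) = sym (dilate-zeros i)
fib-even (suc n) = begin
  ⟦ fib (2 * suc n) ⟧                                       ≈⟨ ⟦fib⟧-cong (ℕ.*-suc 2 n) ⟩
  ⟦ fib (2 + 2 * n) ⟧                                       ≈⟨ ⟦fib⟧-step (2 * n) ⟩
  x· ⟦ fib (1 + 2 * n) ⟧ ⊕ ⟦ fib (2 * n) ⟧                  ≈⟨ ⊕-cong (x·-cong (fib-odd n)) (fib-even n) ⟩
  x· (dilate ⟦ fib n ⟧ ⊕ dilate ⟦ fib (1 + n) ⟧) ⊕ x· dilate ⟦ fib n ⟧
                                                            ≈⟨ ⊕-congʳ _ (x·-⊕ (dilate ⟦ fib n ⟧) _) ⟩
  x· dilate ⟦ fib n ⟧ ⊕ x· dilate ⟦ fib (1 + n) ⟧ ⊕ x· dilate ⟦ fib n ⟧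
                                                            ≈⟨ f⊕g⊕f≗g (x· dilate ⟦ fib n ⟧) _ ⟩
  x· dilate ⟦ fib (1 + n) ⟧                                 ∎
  where open ≗-Reasoning

fib-odd zero    = begin
  ⟦ fib 1 ⟧                              ≈⟨ ⟦fib1⟧ ⟩
  one                                    ≈⟨ dilate-one ⟨
  dilate one                             ≈⟨ dilate-cong ⟦fib1⟧ ⟨
  dilate ⟦ fib 1 ⟧                       ≈⟨ (λ i → cong (_xor dilate ⟦ fib 1 ⟧ i) (dilate-zeros i)) ⟨
  dilate ⟦ fib 0 ⟧ ⊕ dilate ⟦ fib 1 ⟧   ∎
  where open ≗-Reasoning
fib-odd (suc n) = begin
  ⟦ fib (1 + 2 * suc n) ⟧                                   ≈⟨ ⟦fib⟧-cong (cong suc (ℕ.*-suc 2 n)) ⟩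
  ⟦ fib (3 + 2 * n) ⟧                                       ≈⟨ ⟦fib⟧-step (1 + 2 * n) ⟩
  x· ⟦ fib (2 + 2 * n) ⟧ ⊕ ⟦ fib (1 + 2 * n) ⟧
      ≈⟨ ⊕-cong (x·-cong (λ i → trans (⟦fib⟧-cong (sym (ℕ.*-suc 2 n)) i) (fib-even (suc n) i))) (fib-odd n) ⟩
  x· x· dilate F₁ ⊕ (dilate F₀ ⊕ dilate F₁)
      ≈⟨ (λ i → rotate ((x· x· dilate F₁) i) (dilate F₀ i) (dilate F₁ i)) ⟩
  dilate F₁ ⊕ (x· x· dilate F₁ ⊕ dilate F₀)
      ≈⟨ ⊕-congˡ (dilate F₁) (λ i → trans (dilate-⊕ (x· F₁) F₀ i) (cong (_xor dilate F₀ i) (dilate-x· F₁ i))) ⟨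
  dilate F₁ ⊕ dilate (x· F₁ ⊕ F₀)
      ≈⟨ ⊕-congˡ (dilate F₁) (dilate-cong (⟦fib⟧-step n)) ⟨
  dilate F₁ ⊕ dilate ⟦ fib (2 + n) ⟧    ∎
  where
  open ≗-Reasoning
  F₀ F₁ : Series
  F₀ = ⟦ fib n ⟧
  F₁ = ⟦ fib (1 + n) ⟧
  rotate : ∀ a b c → a xor (b xor c) ≡ c xor (a xor b)
  rotate = solveBool 3 (λ a b c → a :+ (b :+ c) := c :+ (a :+ b)) refl

mersenne : ℕ → ℕ
mersenne zero    = 0
mersenne (suc k) = 1 + 2 * mersenne k

1+mersenne : ∀ k → 1 + mersenne k ≡ 2 ^ k
1+mersenne zero    = refl
1+mersenne (suc k) = trans (sym (ℕ.*-suc 2 (mersenne k))) (cong (2 *_) (1+mersenne k))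

fib-2^ : ∀ k → ⟦ fib (1 + mersenne k) ⟧ ≗ monomial (mersenne k)
fib-2^ zero    = ⟦fib1⟧
fib-2^ (suc k) = begin
  ⟦ fib (2 + 2 * M) ⟧               ≈⟨ ⟦fib⟧-cong (ℕ.*-suc 2 M) ⟨
  ⟦ fib (2 * suc M) ⟧               ≈⟨ fib-even (suc M) ⟩
  x· dilate ⟦ fib (1 + M) ⟧         ≈⟨ x·-cong (dilate-cong (fib-2^ k)) ⟩
  x· dilate (monomial M)            ≈⟨ x·-cong (dilate-monomial M) ⟩
  monomial (1 + 2 * M)              ∎
  where
  open ≗-Reasoning
  M : ℕ
  M = mersenne k

fib-mersenne-step : ∀ k → ⟦ fib (mersenne (suc k)) ⟧ ≗ dilate ⟦ fib (mersenne k) ⟧ ⊕ monomial (2 * mersenne k)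
fib-mersenne-step k = begin
  ⟦ fib (1 + 2 * M) ⟧                              ≈⟨ fib-odd M ⟩
  dilate ⟦ fib M ⟧ ⊕ dilate ⟦ fib (1 + M) ⟧        ≈⟨ ⊕-congˡ (dilate ⟦ fib M ⟧) (dilate-cong (fib-2^ k)) ⟩
  dilate ⟦ fib M ⟧ ⊕ dilate (monomial M)           ≈⟨ ⊕-congˡ (dilate ⟦ fib M ⟧) (dilate-monomial M) ⟩
  dilate ⟦ fib M ⟧ ⊕ monomial (2 * M)              ∎
  where
  open ≗-Reasoning
  M : ℕ
  M = mersenne k

fibLow : ℕ → Series
fibLow u = one ⊕ monomial (4 * u) ⊕ monomial (6 * u) ⊕ monomial (7 * u)

map-fibLow : ∀ (L : Series → Series) → (∀ f g → L (f ⊕ g) ≗ L f ⊕ L g) → ∀ u →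
  L (fibLow u) ≗ L one ⊕ L (monomial (4 * u)) ⊕ L (monomial (6 * u)) ⊕ L (monomial (7 * u))
map-fibLow L L-⊕ u = begin
  L (one ⊕ m 4 ⊕ m 6 ⊕ m 7)                  ≈⟨ L-⊕ (one ⊕ m 4 ⊕ m 6) (m 7) ⟩
  L (one ⊕ m 4 ⊕ m 6) ⊕ L (m 7)              ≈⟨ ⊕-congʳ (L (m 7)) (L-⊕ (one ⊕ m 4) (m 6)) ⟩
  L (one ⊕ m 4) ⊕ L (m 6) ⊕ L (m 7)          ≈⟨ ⊕-congʳ (L (m 7)) (⊕-congʳ (L (m 6)) (L-⊕ one (m 4))) ⟩
  L one ⊕ L (m 4) ⊕ L (m 6) ⊕ L (m 7)        ∎
  where
  open ≗-Reasoning
  m : ℕ → Series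
  m a = monomial (a * u)

dilate-fibLow : ∀ u → dilate (fibLow u) ≗ fibLow (2 * u)
dilate-fibLow u = begin
  dilate (fibLow u)
    ≈⟨ map-fibLow dilate dilate-⊕ u ⟩
  dilate one ⊕ dilate (m 4) ⊕ dilate (m 6) ⊕ dilate (m 7)
    ≈⟨ ⊕-cong (⊕-cong (⊕-cong dilate-one (dilate-m 4)) (dilate-m 6)) (dilate-m 7) ⟩
  fibLow (2 * u) ∎
  where
  open ≗-Reasoning
  m : ℕ → Series
  m a = monomial (a * u)
  dilate-m : ∀ a → dilate (m a) ≗ monomial (a * (2 * u))
  dilate-m a i = trans (dilate-monomial (a * u) i) (monomial-cong (2[au]≡a[2u] a u) i)
    where
    2[au]≡a[2u] : ∀ a u → 2 * (a * u) ≡ a * (2 * u)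
    2[au]≡a[2u] = solve-∀

fib-mersenne-fibLow : ∀ t → ⟦ fib (mersenne (4 + t)) ⟧ ≈ fibLow (2 ^ suc t) mod-x^ (1 + 7 * 2 ^ suc t)
-- At k = 4 the term x^{7u} = x^14 is the new f_8² itself, so the induction cannot start lower.
fib-mersenne-fibLow zero    i i<15 =
  subst (λ j → ⟦ fib 15 ⟧ j ≡ fibLow 2 j) (toℕ-fromℕ< i<15) (fib15≡fibLow2 (fromℕ< i<15))
  where
  fib15≡fibLow2 : ∀ (j : Fin 15) → ⟦ fib 15 ⟧ (toℕ j) ≡ fibLow 2 (toℕ j)
  fib15≡fibLow2 = from-yes (all? (λ (j : Fin 15) → ⟦ fib 15 ⟧ (toℕ j) Bool.≟ fibLow 2 (toℕ j)))
fib-mersenne-fibLow (suc t) i i<1+14u = begin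
  ⟦ fib (mersenne (5 + t)) ⟧ i                              ≡⟨ fib-mersenne-step (4 + t) i ⟩
  dilate ⟦ fib M ⟧ i xor monomial (2 * M) i                 ≡⟨ cong₂ _xor_ low-part high-part ⟩
  dilate (fibLow u) i xor false                             ≡⟨ xor-identityʳ _ ⟩
  dilate (fibLow u) i                                       ≡⟨ dilate-fibLow u i ⟩
  fibLow (2 * u) i                                          ∎
  where
  open ≡-Reasoning
  u M : ℕ
  u = 2 ^ suc t
  M = mersenne (4 + t)
  1+7[2v]≤2[1+7v] : ∀ v → 1 + 7 * (2 * v) ≤ 2 * (1 + 7 * v)
  1+7[2v]≤2[1+7v] v = subst (1 + 7 * (2 * v) ≤_) (1+7[2v]+1≡2[1+7v] v) (ℕ.m≤m+n _ 1)
    where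
    1+7[2v]+1≡2[1+7v] : ∀ v → 1 + 7 * (2 * v) + 1 ≡ 2 * (1 + 7 * v)
    1+7[2v]+1≡2[1+7v] = solve-∀
  -- The new term f_{2^k}² = x^(2M) lies beyond x^(14u), because 2M = 16u − 2.
  1+7[2v]≤2n : ∀ n v → 2 ≤ v → 1 + n ≡ 2 * (2 * (2 * v)) → 1 + 7 * (2 * v) ≤ 2 * n
  1+7[2v]≤2n n (suc zero)    (s≤s ()) _
  1+7[2v]≤2n n (suc (suc w)) _ 1+n≡8v = subst (1 + 7 * (2 * (2 + w)) ≤_) (begin
    1 + 7 * (2 * (2 + w)) + (1 + 2 * w)  ≡⟨ lhs≡ w ⟩
    2 * (15 + 8 * w)                     ≡⟨ cong (2 *_) (ℕ.suc-injective (trans (rhs≡ w) (sym 1+n≡8v))) ⟩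
    2 * n                                ∎) (ℕ.m≤m+n _ (1 + 2 * w))
    where
    lhs≡ : ∀ w → 1 + 7 * (2 * (2 + w)) + (1 + 2 * w) ≡ 2 * (15 + 8 * w)
    lhs≡ = solve-∀
    rhs≡ : ∀ w → 1 + (15 + 8 * w) ≡ 2 * (2 * (2 * (2 + w)))
    rhs≡ = solve-∀
  low-part : dilate ⟦ fib M ⟧ i ≡ dilate (fibLow u) i
  low-part = dilate-mod (1 + 7 * u) (fib-mersenne-fibLow t) i (ℕ.<-≤-trans i<1+14u (1+7[2v]≤2[1+7v] u))
  high-part : monomial (2 * M) i ≡ false
  high-part = x^-below (2 * M) one
    (ℕ.<-≤-trans i<1+14u (1+7[2v]≤2n M u (ℕ.^-monoʳ-≤ 2 {1} {suc t} (s≤s z≤n)) (1+mersenne (4 + t))))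

-- Products with f_m modulo x^(7u+1)

module _ (u : ℕ) (u≥1 : 1 ≤ u) where

  private
    below-[a+b]u : ∀ a b {j} → 8 ≤ a + b → j < 1 + 7 * u → j < a * u + b * u
    below-[a+b]u a b 8≤a+b j<1+7u = ℕ.<-≤-trans j<1+7u (begin
      1 + 7 * u      ≤⟨ ℕ.+-monoˡ-≤ (7 * u) u≥1 ⟩
      8 * u          ≤⟨ ℕ.*-monoˡ-≤ u 8≤a+b ⟩
      (a + b) * u    ≡⟨ ℕ.*-distribʳ-+ u a b ⟩
      a * u + b * u  ∎)
      where open ℕ.≤-Reasoning

  -- Below x^(7u+1) each block x^e·(1 + ⋯ + x^(6u−1)) with e ≥ 4u reaches the top, so it is 1 exactly from x^e on.
  onesMul-fibLow : onesMul (6 * u) (fibLow u) ≈ ones (4 * u) ⊕ monomial (7 * u) mod-x^ (1 + 7 * u)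
  onesMul-fibLow j j<1+7u = begin
    onesMul (6 * u) (fibLow u) j
      ≡⟨ map-fibLow (onesMul (6 * u)) (onesMul-⊕ (6 * u)) u j ⟩
    ((block 0 xor block 4) xor block 6) xor block 7
      ≡⟨ cong₂ _xor_ (cong₂ _xor_ (cong₂ _xor_ (onesMul-monomial (6 * u) 0 j) (block-from 4 (ℕ.m≤m+n 8 2)))
                                  (block-from 6 (ℕ.m≤m+n 8 4)))
                     (block-from 7 (ℕ.m≤m+n 8 5)) ⟩
    ((ones (6 * u) j xor not (j <ᵇ 4 * u)) xor not (j <ᵇ 6 * u)) xor not (j <ᵇ 7 * u)
      ≡⟨ xor-nots (j <ᵇ 4 * u) (j <ᵇ 6 * u) (j <ᵇ 7 * u) ⟩
    (j <ᵇ 4 * u) xor not (j <ᵇ 7 * u)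
      ≡⟨ cong ((j <ᵇ 4 * u) xor_) (monomial-≤ (7 * u) (ℕ.≤-pred j<1+7u)) ⟨
    (ones (4 * u) ⊕ monomial (7 * u)) j ∎
    where
    open ≡-Reasoning
    block : ℕ → Bool
    block a = onesMul (6 * u) (monomial (a * u)) j
    block-from : ∀ a → 8 ≤ a + 6 → block a ≡ not (j <ᵇ a * u)
    block-from a 8≤a+6 = trans (onesMul-monomial (6 * u) (a * u) j)
                               (x^-ones-below (a * u) (6 * u) (below-[a+b]u a 6 8≤a+6 j<1+7u))
    xor-nots : ∀ x y z → ((y xor not x) xor not y) xor not z ≡ x xor not z
    xor-nots false false z = refl
    xor-nots false true  z = refl
    xor-nots true  false z = refl
    xor-nots true  true  z = refl

  x^6u-fibLow : x^ (6 * u) · fibLow u ≈ monomial (6 * u) mod-x^ (1 + 7 * u)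
  x^6u-fibLow j j<1+7u = begin
    (x^ (6 * u) · fibLow u) j
      ≡⟨ map-fibLow (x^ (6 * u) ·_) (x^-⊕ (6 * u)) u j ⟩
    ((shifted 0 xor shifted 4) xor shifted 6) xor shifted 7
      ≡⟨ cong₂ _xor_ (cong₂ _xor_ (cong (shifted 0 xor_) (shifted-vanishes 4 (ℕ.m≤m+n 8 2)))
                                  (shifted-vanishes 6 (ℕ.m≤m+n 8 4)))
                     (shifted-vanishes 7 (ℕ.m≤m+n 8 5)) ⟩
    ((monomial (6 * u) j xor false) xor false) xor false
      ≡⟨ trans (xor-identityʳ _) (trans (xor-identityʳ _) (xor-identityʳ _)) ⟩
    monomial (6 * u) j ∎
    where
    open ≡-Reasoning
    shifted : ℕ → Bool
    shifted a = (x^ (6 * u) · monomial (a * u)) j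
    shifted-vanishes : ∀ a → 8 ≤ 6 + a → shifted a ≡ false
    shifted-vanishes a 8≤6+a = trans (cong-app (sym (x^-+ (6 * u) (a * u) one)) j)
                                     (x^-below (6 * u + a * u) one (below-[a+b]u 6 a 8≤6+a j<1+7u))

  fibLow-⊕-x^6u : fibLow u ⊕ x^ (6 * u) · fibLow u ≈ one ⊕ monomial (4 * u) ⊕ monomial (7 * u) mod-x^ (1 + 7 * u)
  fibLow-⊕-x^6u j j<1+7u = trans (cong (fibLow u j xor_) (x^6u-fibLow j j<1+7u))
    (solveBool 4 (λ a b c d → (((a :+ b) :+ c) :+ d) :+ c := (a :+ b) :+ d) refl
      (one j) (monomial (4 * u) j) (monomial (6 * u) j) (monomial (7 * u) j))

-- Dyadic rationals

infix 7.5 _/2^_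
_/2^_ : ℕ → ℕ → ℚ
a /2^ e = (+ a / 2 ^ e) {{m^n≢0 2 e}}

toℚᵘ-/ : ∀ i n .{{_ : ℕ.NonZero n}} → toℚᵘ (i / n) ℚᵘ.≃ mkℚᵘ i (ℕ.pred n)
toℚᵘ-/ i (suc n) = ℚ.toℚᵘ-fromℚᵘ (mkℚᵘ i n)

+a/n≡+b/n⇒a≡b : ∀ a b n .{{_ : ℕ.NonZero n}} → + a / n ≡ + b / n → a ≡ b
+a/n≡+b/n⇒a≡b a b n@(suc _) a/n≡b/n = ℕ.*-cancelʳ-≡ a b n (ℤ.+-injective (begin
  + (a * n)
    ≡⟨ ℤ.pos-* a n ⟩
  + a ℤ.* + n
    ≡⟨ ℚᵘ.drop-*≡* (ℚᵘ.≃-trans (ℚᵘ.≃-sym (toℚᵘ-/ (+ a) n)) (ℚᵘ.≃-trans (ℚ.toℚᵘ-cong a/n≡b/n) (toℚᵘ-/ (+ b) n))) ⟩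
  + b ℤ.* + n
    ≡⟨ ℤ.pos-* b n ⟨
  + (b * n) ∎))
  where open ≡-Reasoning

a*d≡c*b⇒a/b≡c/d : ∀ a b c d .{{_ : ℕ.NonZero b}} .{{_ : ℕ.NonZero d}} → a * d ≡ c * b → + a / b ≡ + c / d
a*d≡c*b⇒a/b≡c/d a b@(suc _) c d@(suc _) ad≡cb = ℚ.toℚᵘ-injective
  (ℚᵘ.≃-trans (toℚᵘ-/ (+ a) b) (ℚᵘ.≃-trans (*≡* +a*+d≡+c*+b) (ℚᵘ.≃-sym (toℚᵘ-/ (+ c) d))))
  where
  +a*+d≡+c*+b : + a ℤ.* + d ≡ + c ℤ.* + b
  +a*+d≡+c*+b = trans (sym (ℤ.pos-* a d)) (trans (cong +_ ad≡cb) (ℤ.pos-* c b))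

+a/b*+c/d≡+[a*c]/[b*d] : ∀ a b c d .{{_ : ℕ.NonZero b}} .{{_ : ℕ.NonZero d}} →
  (+ a / b) ℚ.* (+ c / d) ≡ (+ (a * c) / (b * d)) {{m*n≢0 b d}}
+a/b*+c/d≡+[a*c]/[b*d] a b@(suc _) c d@(suc _) = ℚ.toℚᵘ-injective (ℚᵘ.≃-trans (ℚ.toℚᵘ-homo-* (+ a / b) (+ c / d))
  (ℚᵘ.≃-trans (ℚᵘ.*-cong (toℚᵘ-/ (+ a) b) (toℚᵘ-/ (+ c) d))
  (ℚᵘ.≃-trans (*≡* (cong (ℤ._* + (b * d)) (sym (ℤ.pos-* a c)))) (ℚᵘ.≃-sym (toℚᵘ-/ (+ (a * c)) (b * d) {{m*n≢0 b d}})))))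

[a+b]/n≡a/n+b/n : ∀ a b n .{{_ : ℕ.NonZero n}} → + (a + b) / n ≡ + a / n ℚ.+ + b / n
[a+b]/n≡a/n+b/n a b n@(suc _) = ℚ.toℚᵘ-injective (ℚᵘ.≃-trans (toℚᵘ-/ (+ (a + b)) n)
  (ℚᵘ.≃-trans (*≡* cross) (ℚᵘ.≃-sym (ℚᵘ.≃-trans (ℚ.toℚᵘ-homo-+ (+ a / n) (+ b / n))
                                                (ℚᵘ.+-cong (toℚᵘ-/ (+ a) n) (toℚᵘ-/ (+ b) n))))))
  where
  open ≡-Reasoning
  regroup : ∀ a b n → (a + b) * (n * n) ≡ (a * n + b * n) * n
  regroup = solve-∀
  cross : + (a + b) ℤ.* + (n * n) ≡ (+ a ℤ.* + n ℤ.+ + b ℤ.* + n) ℤ.* + n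
  cross = begin
    + (a + b) ℤ.* + (n * n)
      ≡⟨ ℤ.pos-* (a + b) (n * n) ⟨
    + ((a + b) * (n * n))
      ≡⟨ cong +_ (regroup a b n) ⟩
    + ((a * n + b * n) * n)
      ≡⟨ ℤ.pos-* (a * n + b * n) n ⟩
    + (a * n + b * n) ℤ.* + n
      ≡⟨ cong (ℤ._* + n) (trans (ℤ.pos-+ (a * n) (b * n)) (cong₂ ℤ._+_ (ℤ.pos-* a n) (ℤ.pos-* b n))) ⟩
    (+ a ℤ.* + n ℤ.+ + b ℤ.* + n) ℤ.* + n ∎

∣p-[p+q]∣≡q : ∀ p q → 0ℚ ℚ.≤ q → ℚ.∣ p ℚ.- (p ℚ.+ q) ∣ ≡ q
∣p-[p+q]∣≡q p q 0≤q = begin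
  ℚ.∣ p ℚ.+ ℚ.- (p ℚ.+ q) ∣           ≡⟨ cong (λ r → ℚ.∣ p ℚ.+ r ∣) (ℚ.neg-distrib-+ p q) ⟩
  ℚ.∣ p ℚ.+ (ℚ.- p ℚ.+ ℚ.- q) ∣       ≡⟨ cong ℚ.∣_∣ (ℚ.+-assoc p (ℚ.- p) (ℚ.- q)) ⟨
  ℚ.∣ (p ℚ.- p) ℚ.+ ℚ.- q ∣           ≡⟨ cong (λ r → ℚ.∣ r ℚ.+ ℚ.- q ∣) (ℚ.+-inverseʳ p) ⟩
  ℚ.∣ 0ℚ ℚ.+ ℚ.- q ∣                  ≡⟨ cong ℚ.∣_∣ (ℚ.+-identityˡ (ℚ.- q)) ⟩
  ℚ.∣ ℚ.- q ∣                         ≡⟨ ℚ.∣-p∣≡∣p∣ q ⟩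
  ℚ.∣ q ∣                             ≡⟨ ℚ.0≤p⇒∣p∣≡p 0≤q ⟩
  q                                   ∎
  where open ≡-Reasoning

0≤a/2^e : ∀ a e → 0ℚ ℚ.≤ a /2^ e
0≤a/2^e a e = ℚ.nonNegative⁻¹ (a /2^ e) {{ℚ.normalize-nonNeg a (2 ^ e) {{m^n≢0 2 e}}}}

dist∞-shift : ∀ a b d e → dist∞ (a /2^ e , b /2^ e) ((a + d) /2^ e , (b + d) /2^ e) ≡ d /2^ e
dist∞-shift a b d e = trans (cong₂ ℚ._⊔_ (coordinate a) (coordinate b)) (ℚ.⊔-idem (d /2^ e))
  where
  instance _ = m^n≢0 2 e
  coordinate : ∀ c → ℚ.∣ c /2^ e ℚ.- (c + d) /2^ e ∣ ≡ d /2^ e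
  coordinate c = trans (cong (λ r → ℚ.∣ c /2^ e ℚ.- r ∣) ([a+b]/n≡a/n+b/n c d (2 ^ e)))
                       (∣p-[p+q]∣≡q (c /2^ e) (d /2^ e) (0≤a/2^e d e))

2^a/2^[a+b]≡1/2^b : ∀ a b → 2 ^ a /2^ (a + b) ≡ 1 /2^ b
2^a/2^[a+b]≡1/2^b a b = a*d≡c*b⇒a/b≡c/d (2 ^ a) (2 ^ (a + b)) 1 (2 ^ b) {{m^n≢0 2 (a + b)}} {{m^n≢0 2 b}}
  (trans (sym (ℕ.^-distribˡ-+-* 2 a b)) (sym (ℕ.*-identityˡ (2 ^ (a + b)))))

1/2^a*1/2^b≡1/2^[a+b] : ∀ a b → 1 /2^ a ℚ.* 1 /2^ b ≡ 1 /2^ (a + b)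
1/2^a*1/2^b≡1/2^[a+b] a b =
  trans (+a/b*+c/d≡+[a*c]/[b*d] 1 (2 ^ a) 1 (2 ^ b)) (ℚ./-cong {p₁ = + 1} refl (sym (ℕ.^-distribˡ-+-* 2 a b)))
  where
  instance
    _ = m^n≢0 2 a
    _ = m^n≢0 2 b
    _ = m^n≢0 2 (a + b)
    _ = m*n≢0 (2 ^ a) (2 ^ b)

[1/2^a]^k≡1/2^[k*a] : ∀ a k → (1 /2^ a) ^ℚ k ≡ 1 /2^ (k * a)
[1/2^a]^k≡1/2^[k*a] a zero    = refl
[1/2^a]^k≡1/2^[k*a] a (suc k) =
  trans (cong (1 /2^ a ℚ.*_) ([1/2^a]^k≡1/2^[k*a] a k)) (1/2^a*1/2^b≡1/2^[a+b] a (k * a))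

^ℚ-nonNeg : ∀ {r} k → 0ℚ ℚ.≤ r → 0ℚ ℚ.≤ r ^ℚ k
^ℚ-nonNeg zero    0≤r = ℚ.nonNegative⁻¹ 1ℚ
^ℚ-nonNeg {r} (suc k) 0≤r = ℚ.nonNegative⁻¹ (r ℚ.* r ^ℚ k)
  {{ℚ.nonNeg*nonNeg⇒nonNeg r {{ℚ.nonNegative 0≤r}} (r ^ℚ k) {{ℚ.nonNegative (^ℚ-nonNeg k 0≤r)}}}}

^ℚ-mono : ∀ {r s} k → 0ℚ ℚ.≤ r → r ℚ.≤ s → r ^ℚ k ℚ.≤ s ^ℚ k
^ℚ-mono zero    0≤r r≤s = ℚ.≤-refl
^ℚ-mono {r} {s} (suc k) 0≤r r≤s = ℚ.≤-trans
  (ℚ.*-monoʳ-≤-nonNeg (r ^ℚ k) {{ℚ.nonNegative (^ℚ-nonNeg k 0≤r)}} r≤s)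
  (ℚ.*-monoˡ-≤-nonNeg s {{ℚ.nonNegative (ℚ.≤-trans 0≤r r≤s)}} (^ℚ-mono k 0≤r r≤s))

ν-monomial : ∀ M p → ⟦ p ⟧ ≗ monomial M → ∀ a → ν M a p ≡ eval₂ M ⟦ a ⟧ /2^ M
ν-monomial M p p≗xᴹ a = cong (_/2^ M) (νScaled-monomial M p p≗xᴹ a)

lpPoint-monomial : ∀ p q M {n} → ⟦ p ⟧ ≗ monomial M → n < 2 ^ M →
  lpPoint p (fib 1) q n ≡ (n /2^ M , eval₂ M ⟦ digitsPoly M n *ₚ q ⟧ /2^ M)
lpPoint-monomial p q M {n} p≗xᴹ n<2ᴹ = begin
  lpPoint p (fib 1) q n
    ≡⟨ cong (λ m → ν m (digitsPoly m n *ₚ fib 1) p , ν m (digitsPoly m n *ₚ q) p) (deg-monomial p M p≗xᴹ) ⟩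
  (ν M (digitsPoly M n *ₚ fib 1) p , ν M (digitsPoly M n *ₚ q) p)
    ≡⟨ cong₂ _,_ (trans (ν-monomial M p p≗xᴹ _) (cong (_/2^ M) first-coordinate)) (ν-monomial M p p≗xᴹ _) ⟩
  (n /2^ M , eval₂ M ⟦ digitsPoly M n *ₚ q ⟧ /2^ M) ∎
  where
  open ≡-Reasoning
  first-coordinate : eval₂ M ⟦ digitsPoly M n *ₚ fib 1 ⟧ ≡ n
  first-coordinate = trans (eval₂-cong M (λ i _ → ⟦⟧-*ₚ-1 (digitsPoly M n) i)) (eval₂-digitsPoly M n n<2ᴹ)

lpPoint∈lpSet : ∀ p q₁ q₂ {n} → n < 2 ^ deg p → lpPoint p q₁ q₂ n ∈ lpSet p q₁ q₂
lpPoint∈lpSet p q₁ q₂ n<2ᵈ = ∈-map⁺ _ (∈-upTo⁺ n<2ᵈ)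

-- The separation radius

∈-pairs⁺ : ∀ {A B : Set} {g : A → A → List B} {Q : List A} {x y z} →
  x ∈ Q → y ∈ Q → z ∈ g x y → z ∈ concatMap (λ x → concatMap (g x) Q) Q
∈-pairs⁺ x∈Q y∈Q z∈gxy = ∈-concatMap⁺ _ (lose x∈Q (∈-concatMap⁺ _ (lose y∈Q z∈gxy)))

∈-pairs⁻ : ∀ {A B : Set} (g : A → A → List B) (Q : List A) {z} →
  z ∈ concatMap (λ x → concatMap (g x) Q) Q → ∃ λ x → ∃ λ y → z ∈ g x y
∈-pairs⁻ g Q z∈ with satisfied (∈-concatMap⁻ (λ x → concatMap (g x) Q) {Q} z∈)
... | x , z∈gx = x , satisfied (∈-concatMap⁻ (g x) {Q} z∈gx)

-- pairDists tests a₁ ≟ b₁ in a local function; the annotated ∈-pairs⁺ exposes that test to the with.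
half-dist∈pairDists : ∀ {Q a₁ a₂ b₁ b₂} → (a₁ , a₂) ∈ Q → (b₁ , b₂) ∈ Q → a₁ ≢ b₁ →
  half ℚ.* dist∞ (a₁ , a₂) (b₁ , b₂) ∈ pairDists Q
half-dist∈pairDists {Q} {a₁} {a₂} {b₁} {b₂} x∈Q y∈Q a₁≢b₁
  with a₁ ℚ.≟ b₁ | (∀ {z} → z ∈ _ → z ∈ pairDists Q) ∋ ∈-pairs⁺ x∈Q y∈Q
... | yes a₁≡b₁ | _    = ⊥-elim (a₁≢b₁ a₁≡b₁)
... | no _      | into = into (here refl)

0≤half-dist∞ : ∀ x y → 0ℚ ℚ.≤ half ℚ.* dist∞ x y
0≤half-dist∞ (a₁ , a₂) (b₁ , b₂) = ℚ.nonNegative⁻¹ _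
  {{ℚ.nonNeg*nonNeg⇒nonNeg half (dist∞ (a₁ , a₂) (b₁ , b₂)) {{ℚ.nonNegative 0≤dist∞}}}}
  where
  0≤dist∞ : 0ℚ ℚ.≤ dist∞ (a₁ , a₂) (b₁ , b₂)
  0≤dist∞ = ℚ.≤-trans (ℚ.0≤∣p∣ (a₁ ℚ.- b₁)) (ℚ.p≤p⊔q _ _)

0≤pairDists : ∀ Q {z} → z ∈ pairDists Q → 0ℚ ℚ.≤ z
0≤pairDists Q z∈ with (∃ λ x → ∃ λ y → _ ∈ _) ∋ ∈-pairs⁻ _ Q z∈
... | (a₁ , a₂) , (b₁ , b₂) , z∈fxy with a₁ ℚ.≟ b₁ | a₂ ℚ.≟ b₂ | z∈fxy
...   | yes _ | yes _ | ()
...   | yes _ | no _  | here refl = 0≤half-dist∞ (a₁ , a₂) (b₁ , b₂)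
...   | no _  | _     | here refl = 0≤half-dist∞ (a₁ , a₂) (b₁ , b₂)

minimum-∷ : ∀ x xs → (∀ {z} → z ∈ x ∷ xs → 0ℚ ℚ.≤ z) →
  ∃ λ r → minimum (x ∷ xs) ≡ just r × 0ℚ ℚ.≤ r × (∀ {z} → z ∈ x ∷ xs → r ℚ.≤ z)
minimum-∷ x []       0≤ = x , refl , 0≤ (here refl) , λ { (here refl) → ℚ.≤-refl }
minimum-∷ x (y ∷ ys) 0≤ with minimum-∷ y ys (0≤ ∘ there)
... | s , min≡s , 0≤s , s≤ rewrite min≡s =
  x ℚ.⊓ s , refl , ℚ.⊓-glb (0≤ (here refl)) 0≤s ,
  λ { (here refl) → ℚ.p⊓q≤p x s ; (there z∈) → ℚ.≤-trans (ℚ.p⊓q≤q x s) (s≤ z∈) }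

qInf≤half-dist∞ : ∀ {Q x y} → x ∈ Q → y ∈ Q → proj₁ x ≢ proj₁ y →
  ∃ λ r → qInf Q ≡ just r × 0ℚ ℚ.≤ r × r ℚ.≤ half ℚ.* dist∞ x y
qInf≤half-dist∞ {Q} x∈Q y∈Q x₁≢y₁ with pairDists Q | half-dist∈pairDists x∈Q y∈Q x₁≢y₁ | 0≤pairDists Q
... | z ∷ zs | e∈ | 0≤ with minimum-∷ z zs 0≤
...   | r , min≡r , 0≤r , r≤ = r , min≡r , 0≤r , r≤ e∈

qInf^k≤1/2^[k*[1+b]] : ∀ {Q x y} k b → x ∈ Q → y ∈ Q → proj₁ x ≢ proj₁ y → dist∞ x y ≡ 1 /2^ b →
  ∃ λ r → qInf Q ≡ just r × r ^ℚ k ℚ.≤ 1 /2^ (k * (1 + b))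
qInf^k≤1/2^[k*[1+b]] {x = x} {y} k b x∈Q y∈Q x₁≢y₁ dist≡ with qInf≤half-dist∞ x∈Q y∈Q x₁≢y₁
... | r , qInf≡r , 0≤r , r≤ = r , qInf≡r , (begin
  r ^ℚ k                          ≤⟨ ^ℚ-mono k 0≤r r≤ ⟩
  (half ℚ.* dist∞ x y) ^ℚ k       ≡⟨ cong (λ d → (half ℚ.* d) ^ℚ k) dist≡ ⟩
  (1 /2^ 1 ℚ.* 1 /2^ b) ^ℚ k      ≡⟨ cong (_^ℚ k) (1/2^a*1/2^b≡1/2^[a+b] 1 b) ⟩
  (1 /2^ (1 + b)) ^ℚ k            ≡⟨ [1/2^a]^k≡1/2^[k*a] (1 + b) k ⟩
  1 /2^ (k * (1 + b))             ∎)
  where open ℚ.≤-Reasoning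

-- Two close points

module ClosePair (w u : ℕ) (u≥1 : 1 ≤ u) (p q : Poly)
                 (p≗xᴹ : ⟦ p ⟧ ≗ monomial (w + (1 + 7 * u)))
                 (q≈fibLow : ⟦ q ⟧ ≈ fibLow u mod-x^ (1 + 7 * u)) where

  K M : ℕ
  K = 1 + 7 * u
  M = w + K

  n₋ n₊ : ℕ
  n₋ = 2 ^ (w + 6 * u) ∸ 2 ^ w
  n₊ = 2 ^ (w + 6 * u) + 2 ^ w

  s₋ : ℕ
  s₋ = 2 ^ w * (eval₂ K (ones (4 * u)) + 2 ^ (7 * u))

  private
    instance _ = ℕ.>-nonZero u≥1

    0<[1+a]u : ∀ a → 0 < suc a * u
    0<[1+a]u a = ℕ.<-≤-trans (s≤s z≤n) (ℕ.*-monoʳ-≤ (suc a) u≥1)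

    4u<7u : 4 * u < 7 * u
    4u<7u = ℕ.*-monoˡ-< u (ℕ.m≤m+n 5 2)

    4u<K : 4 * u < K
    4u<K = ℕ.<-trans 4u<7u (ℕ.n<1+n (7 * u))

    K≡6u+[1+u] : K ≡ 6 * u + (1 + u)
    K≡6u+[1+u] = 1+7u≡6u+[1+u] u
      where
      1+7u≡6u+[1+u] : ∀ u → 1 + 7 * u ≡ 6 * u + (1 + u)
      1+7u≡6u+[1+u] = solve-∀

    n₋≡2^w*[2^6u∸1] : n₋ ≡ 2 ^ w * (2 ^ (6 * u) ∸ 1)
    n₋≡2^w*[2^6u∸1] = begin
      2 ^ (w + 6 * u) ∸ 2 ^ w              ≡⟨ cong₂ _∸_ (ℕ.^-distribˡ-+-* 2 w (6 * u)) (sym (ℕ.*-identityʳ (2 ^ w))) ⟩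
      2 ^ w * 2 ^ (6 * u) ∸ 2 ^ w * 1      ≡⟨ ℕ.*-distribˡ-∸ (2 ^ w) (2 ^ (6 * u)) 1 ⟨
      2 ^ w * (2 ^ (6 * u) ∸ 1)            ∎
      where open ≡-Reasoning

    n₊≡2^w*[1+2^6u] : n₊ ≡ 2 ^ w * (1 + 2 ^ (6 * u))
    n₊≡2^w*[1+2^6u] = trans (cong (_+ 2 ^ w) (ℕ.^-distribˡ-+-* 2 w (6 * u))) (regroup (2 ^ w) (2 ^ (6 * u)))
      where
      regroup : ∀ a b → a * b + a ≡ a * (1 + b)
      regroup = solve-∀

    c : ℕ
    c = 6 * u ∸ 1

    1+c≡6u : suc c ≡ 6 * u
    1+c≡6u = ℕ.m+[n∸m]≡n (0<[1+a]u 5)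

    product₋ : ⟦ digitsPoly M n₋ *ₚ q ⟧ ≗ x^ w · onesMul (6 * u) ⟦ q ⟧
    product₋ = begin
      ⟦ digitsPoly (w + K) n₋ *ₚ q ⟧
        ≈⟨ cong-app (cong (λ n → ⟦ digitsPoly M n *ₚ q ⟧) n₋≡2^w*[2^6u∸1]) ⟩
      ⟦ digitsPoly (w + K) (2 ^ w * (2 ^ (6 * u) ∸ 1)) *ₚ q ⟧
        ≈⟨ ⟦digitsPoly-2^*⟧ w K (2 ^ (6 * u) ∸ 1) q ⟩
      x^ w · ⟦ digitsPoly K (2 ^ (6 * u) ∸ 1) *ₚ q ⟧
        ≈⟨ x^-cong w (cong-app (cong (λ L → ⟦ L *ₚ q ⟧) digits)) ⟩
      x^ w · ⟦ (replicate (6 * u) true ++ replicate (1 + u) false) *ₚ q ⟧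
        ≈⟨ x^-cong w (⟦⟧-ones*ₚ (6 * u) (1 + u) q) ⟩
      x^ w · onesMul (6 * u) ⟦ q ⟧ ∎
      where
      open ≗-Reasoning
      digits : digitsPoly K (2 ^ (6 * u) ∸ 1) ≡ replicate (6 * u) true ++ replicate (1 + u) false
      digits = trans (cong (λ k → digitsPoly k (2 ^ (6 * u) ∸ 1)) K≡6u+[1+u]) (digitsPoly-2^∸1 (6 * u) (1 + u))

    product₊ : ⟦ digitsPoly M n₊ *ₚ q ⟧ ≗ x^ w · (⟦ q ⟧ ⊕ x^ (6 * u) · ⟦ q ⟧)
    product₊ = begin
      ⟦ digitsPoly (w + K) n₊ *ₚ q ⟧
        ≈⟨ cong-app (cong (λ n → ⟦ digitsPoly M n *ₚ q ⟧) n₊≡2^w*[1+2^6u]) ⟩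
      ⟦ digitsPoly (w + K) (2 ^ w * (1 + 2 ^ (6 * u))) *ₚ q ⟧
        ≈⟨ ⟦digitsPoly-2^*⟧ w K (1 + 2 ^ (6 * u)) q ⟩
      x^ w · ⟦ digitsPoly K (1 + 2 ^ (6 * u)) *ₚ q ⟧
        ≈⟨ x^-cong w (cong-app (cong (λ L → ⟦ L *ₚ q ⟧) digits)) ⟩
      x^ w · ⟦ (true ∷ replicate c false ++ true ∷ replicate u false) *ₚ q ⟧
        ≈⟨ x^-cong w (⟦⟧-1+x¹⁺ᶜ*ₚ c u q) ⟩
      x^ w · (⟦ q ⟧ ⊕ x^ suc c · ⟦ q ⟧)
        ≈⟨ cong-app (cong (λ e → x^ w · (⟦ q ⟧ ⊕ x^ e · ⟦ q ⟧)) 1+c≡6u) ⟩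
      x^ w · (⟦ q ⟧ ⊕ x^ (6 * u) · ⟦ q ⟧) ∎
      where
      open ≗-Reasoning
      K≡1+[c+[1+u]] : K ≡ suc (c + suc u)
      K≡1+[c+[1+u]] = trans K≡6u+[1+u] (cong (_+ suc u) (sym 1+c≡6u))
      digits : digitsPoly K (1 + 2 ^ (6 * u)) ≡ true ∷ replicate c false ++ true ∷ replicate u false
      digits = trans (cong₂ (λ k e → digitsPoly k (1 + 2 ^ e)) K≡1+[c+[1+u]] (sym 1+c≡6u)) (digitsPoly-1+2^[1+c] c u)

  n₋+2^[1+w]≡n₊ : n₋ + 2 ^ suc w ≡ n₊
  n₋+2^[1+w]≡n₊ = begin
    (X ∸ 2 ^ w) + 2 * 2 ^ w        ≡⟨ regroup (X ∸ 2 ^ w) (2 ^ w) ⟩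
    (X ∸ 2 ^ w) + 2 ^ w + 2 ^ w    ≡⟨ cong (_+ 2 ^ w) (ℕ.m∸n+n≡m (ℕ.^-monoʳ-≤ 2 (ℕ.m≤m+n w (6 * u)))) ⟩
    X + 2 ^ w                      ∎
    where
    open ≡-Reasoning
    X : ℕ
    X = 2 ^ (w + 6 * u)
    regroup : ∀ a y → a + 2 * y ≡ a + y + y
    regroup = solve-∀

  n₊<2ᴹ : n₊ < 2 ^ M
  n₊<2ᴹ = begin-strict
    n₊                             ≡⟨ n₊≡2^w*[1+2^6u] ⟩
    2 ^ w * (1 + 2 ^ (6 * u))      ≤⟨ ℕ.*-monoʳ-≤ (2 ^ w) 1+X≤2X ⟩
    2 ^ w * 2 ^ (1 + 6 * u)        <⟨ ℕ.*-monoʳ-< (2 ^ w) {{m^n≢0 2 w}} 2^[1+6u]<2^K ⟩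
    2 ^ w * 2 ^ K                  ≡⟨ ℕ.^-distribˡ-+-* 2 w K ⟨
    2 ^ M                          ∎
    where
    open ℕ.≤-Reasoning
    1+X≤2X : 1 + 2 ^ (6 * u) ≤ 2 * 2 ^ (6 * u)
    1+X≤2X = subst (1 + 2 ^ (6 * u) ≤_) (cong (2 ^ (6 * u) ℕ.+_) (sym (ℕ.+-identityʳ (2 ^ (6 * u)))))
                   (ℕ.+-monoˡ-≤ (2 ^ (6 * u)) (ℕ.m^n>0 2 (6 * u)))
    2^[1+6u]<2^K : 2 ^ (1 + 6 * u) < 2 ^ K
    2^[1+6u]<2^K = ℕ.^-monoʳ-< 2 (ℕ.n<1+n 1) (s≤s (ℕ.*-monoˡ-< u (ℕ.n<1+n 6)))

  n₋<2ᴹ : n₋ < 2 ^ M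
  n₋<2ᴹ = ℕ.≤-<-trans (subst (n₋ ≤_) n₋+2^[1+w]≡n₊ (ℕ.m≤m+n n₋ (2 ^ suc w))) n₊<2ᴹ

  eval₂-product₋ : eval₂ M ⟦ digitsPoly M n₋ *ₚ q ⟧ ≡ s₋
  eval₂-product₋ = begin
    eval₂ M ⟦ digitsPoly M n₋ *ₚ q ⟧                     ≡⟨ eval₂-cong M (λ i _ → product₋ i) ⟩
    eval₂ (w + K) (x^ w · onesMul (6 * u) ⟦ q ⟧)         ≡⟨ eval₂-x^ w K (onesMul (6 * u) ⟦ q ⟧) ⟩
    2 ^ w * eval₂ K (onesMul (6 * u) ⟦ q ⟧)              ≡⟨ cong (2 ^ w *_) (eval₂-cong K low-terms) ⟩
    2 ^ w * eval₂ K (ones (4 * u) ⊕ monomial (7 * u))    ≡⟨ cong (2 ^ w *_) top-bit ⟩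
    s₋                                                   ∎
    where
    open ≡-Reasoning
    low-terms : onesMul (6 * u) ⟦ q ⟧ ≈ ones (4 * u) ⊕ monomial (7 * u) mod-x^ K
    low-terms = mod-trans K (onesMul-mod (6 * u) K q≈fibLow) (onesMul-fibLow u u≥1)
    top-bit : eval₂ K (ones (4 * u) ⊕ monomial (7 * u)) ≡ eval₂ K (ones (4 * u)) + 2 ^ (7 * u)
    top-bit = eval₂-⊕-monomial K (7 * u) (ones (4 * u)) (ℕ.n<1+n (7 * u)) (ones-above (4 * u) (ℕ.<⇒≤ 4u<7u))

  eval₂-product₊ : eval₂ M ⟦ digitsPoly M n₊ *ₚ q ⟧ ≡ s₋ + 2 ^ suc w
  eval₂-product₊ = begin
    eval₂ M ⟦ digitsPoly M n₊ *ₚ q ⟧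
      ≡⟨ eval₂-cong M (λ i _ → product₊ i) ⟩
    eval₂ (w + K) (x^ w · (⟦ q ⟧ ⊕ x^ (6 * u) · ⟦ q ⟧))
      ≡⟨ eval₂-x^ w K (⟦ q ⟧ ⊕ x^ (6 * u) · ⟦ q ⟧) ⟩
    2 ^ w * eval₂ K (⟦ q ⟧ ⊕ x^ (6 * u) · ⟦ q ⟧)
      ≡⟨ cong (2 ^ w *_) (eval₂-cong K low-terms) ⟩
    2 ^ w * eval₂ K (one ⊕ monomial (4 * u) ⊕ monomial (7 * u))
      ≡⟨ cong (2 ^ w *_) (eval₂-⊕-monomial K (7 * u) (one ⊕ monomial (4 * u)) (ℕ.n<1+n (7 * u))
           (cong₂ _xor_ (monomial-above 0 (0<[1+a]u 6)) (monomial-above (4 * u) 4u<7u))) ⟩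
    2 ^ w * (eval₂ K (one ⊕ monomial (4 * u)) + 2 ^ (7 * u))
      ≡⟨ cong (λ e → 2 ^ w * (e + 2 ^ (7 * u))) (eval₂-⊕-monomial K (4 * u) one 4u<K (monomial-above 0 (0<[1+a]u 3))) ⟩
    2 ^ w * ((eval₂ K one + 2 ^ (4 * u)) + 2 ^ (7 * u))
      ≡⟨ cong (λ e → 2 ^ w * ((e + 2 ^ (4 * u)) + 2 ^ (7 * u))) (eval₂-one (7 * u)) ⟩
    2 ^ w * ((1 + 2 ^ (4 * u)) + 2 ^ (7 * u))
      ≡⟨ cong (λ e → 2 ^ w * ((1 + e) + 2 ^ (7 * u))) (eval₂-ones (4 * u) K (ℕ.<⇒≤ 4u<K)) ⟨
    2 ^ w * ((1 + (eval₂ K (ones (4 * u)) + 1)) + 2 ^ (7 * u))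
      ≡⟨ regroup (2 ^ w) (eval₂ K (ones (4 * u))) (2 ^ (7 * u)) ⟩
    s₋ + 2 ^ suc w ∎
    where
    open ≡-Reasoning
    low-terms : ⟦ q ⟧ ⊕ x^ (6 * u) · ⟦ q ⟧ ≈ one ⊕ monomial (4 * u) ⊕ monomial (7 * u) mod-x^ K
    low-terms = mod-trans K (⊕-mod K q≈fibLow (x^-mod (6 * u) K q≈fibLow)) (fibLow-⊕-x^6u u u≥1)
    regroup : ∀ a e b → a * ((1 + (e + 1)) + b) ≡ a * (e + b) + 2 * a
    regroup = solve-∀

  point₋ : lpPoint p (fib 1) q n₋ ≡ (n₋ /2^ M , s₋ /2^ M)
  point₋ = trans (lpPoint-monomial p q M p≗xᴹ n₋<2ᴹ) (cong (λ s → n₋ /2^ M , s /2^ M) eval₂-product₋)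

  point₊ : lpPoint p (fib 1) q n₊ ≡ ((n₋ + 2 ^ suc w) /2^ M , (s₋ + 2 ^ suc w) /2^ M)
  point₊ = trans (lpPoint-monomial p q M p≗xᴹ n₊<2ᴹ)
                 (cong₂ (λ n s → n /2^ M , s /2^ M) (sym n₋+2^[1+w]≡n₊) eval₂-product₊)

  dist∞-point₋-point₊ : dist∞ (lpPoint p (fib 1) q n₋) (lpPoint p (fib 1) q n₊) ≡ 1 /2^ (7 * u)
  dist∞-point₋-point₊ = begin
    dist∞ (lpPoint p (fib 1) q n₋) (lpPoint p (fib 1) q n₊)
      ≡⟨ cong₂ dist∞ point₋ point₊ ⟩
    dist∞ (n₋ /2^ M , s₋ /2^ M) ((n₋ + 2 ^ suc w) /2^ M , (s₋ + 2 ^ suc w) /2^ M)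
      ≡⟨ dist∞-shift n₋ s₋ (2 ^ suc w) M ⟩
    2 ^ suc w /2^ M
      ≡⟨ cong (2 ^ suc w /2^_) (ℕ.+-suc w (7 * u)) ⟩
    2 ^ suc w /2^ (suc w + 7 * u)
      ≡⟨ 2^a/2^[a+b]≡1/2^b (suc w) (7 * u) ⟩
    1 /2^ (7 * u) ∎
    where open ≡-Reasoning

  point₋≢point₊ : proj₁ (lpPoint p (fib 1) q n₋) ≢ proj₁ (lpPoint p (fib 1) q n₊)
  point₋≢point₊ eq = ℕ.<⇒≢ (ℕ.m<m+n n₋ (ℕ.m^n>0 2 (suc w))) n₋≡n₋+2^[1+w]
    where
    n₋≡n₋+2^[1+w] : n₋ ≡ n₋ + 2 ^ suc w
    n₋≡n₋+2^[1+w] = +a/n≡+b/n⇒a≡b n₋ (n₋ + 2 ^ suc w) (2 ^ M) {{m^n≢0 2 M}}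
      (trans (sym (cong proj₁ point₋)) (trans eq (cong proj₁ point₊)))

  point∈lpSet : ∀ {n} → n < 2 ^ M → lpPoint p (fib 1) q n ∈ lpSet p (fib 1) q
  point∈lpSet {n} n<2ᴹ = lpPoint∈lpSet p (fib 1) q (subst (λ m → n < 2 ^ m) (sym (deg-monomial p M p≗xᴹ)) n<2ᴹ)

2^15*[2^m]^7≢0 : ∀ m → ℕ.NonZero (2 ^ 15 * (2 ^ m) ^ 7)
2^15*[2^m]^7≢0 m = m*n≢0 (2 ^ 15) ((2 ^ m) ^ 7) {{m^n≢0 2 15}} {{m^n≢0 (2 ^ m) 7 {{m^n≢0 2 m}}}}

fibonacci-close-pair : ∀ w m m′ p q → m ≡ w + (1 + 7 * (2 + w)) → m′ ≡ 1 + w →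
  ⟦ p ⟧ ≗ monomial m → ⟦ q ⟧ ≈ fibLow (2 + w) mod-x^ (1 + 7 * (2 + w)) →
  (dist∞ (lpPoint p (fib 1) q (2 ^ (m ∸ m′ ∸ 2) ∸ 2 ^ (m′ ∸ 1))) (lpPoint p (fib 1) q (2 ^ (m ∸ m′ ∸ 2) + 2 ^ (m′ ∸ 1)))
     ≡ 1 /2^ (m ∸ m′))
  × ∃ λ r → qInf (lpSet p (fib 1) q) ≡ just r × r ^ℚ 8 ℚ.≤ (+ 1 / (2 ^ 15 * (2 ^ m) ^ 7)) {{2^15*[2^m]^7≢0 m}}
fibonacci-close-pair w m m′ p q refl refl p≗xᵐ q≈fibLow =
  trans (cong (λ e → dist∞ (lpPoint p (fib 1) q (2 ^ e ∸ 2 ^ w)) (lpPoint p (fib 1) q (2 ^ e + 2 ^ w))) m∸m′∸2≡w+6u)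
        (trans dist∞-point₋-point₊ (cong (1 /2^_) (sym m∸m′≡7u))) ,
  subst (λ B → ∃ λ r → qInf (lpSet p (fib 1) q) ≡ just r × r ^ℚ 8 ℚ.≤ B)
        (ℚ./-cong {p₁ = + 1} {{m^n≢0 2 (8 * (1 + 7 * u))}} {{2^15*[2^m]^7≢0 m}} refl exponents)
        (qInf^k≤1/2^[k*[1+b]] 8 (7 * u) (point∈lpSet n₋<2ᴹ) (point∈lpSet n₊<2ᴹ) point₋≢point₊ dist∞-point₋-point₊)
  where
  u : ℕ
  u = 2 + w
  open ClosePair w u (s≤s z≤n) p q p≗xᵐ q≈fibLow
  m∸m′≡7u : m ∸ m′ ≡ 7 * u
  m∸m′≡7u = trans (cong (_∸ m′) (ℕ.+-suc w (7 * u))) (ℕ.m+n∸m≡n w (7 * u))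
  m∸m′∸2≡w+6u : m ∸ m′ ∸ 2 ≡ w + 6 * u
  m∸m′∸2≡w+6u = cong (_∸ 2) (trans m∸m′≡7u (7u≡2+[w+6u] w))
    where
    7u≡2+[w+6u] : ∀ w → 7 * (2 + w) ≡ 2 + (w + 6 * (2 + w))
    7u≡2+[w+6u] = solve-∀
  exponents : 2 ^ (8 * (1 + 7 * u)) ≡ 2 ^ 15 * (2 ^ m) ^ 7
  exponents = begin
    2 ^ (8 * (1 + 7 * u))     ≡⟨ cong (2 ^_) (8[1+7u]≡15+m*7 w) ⟩
    2 ^ (15 + m * 7)          ≡⟨ ℕ.^-distribˡ-+-* 2 15 (m * 7) ⟩
    2 ^ 15 * 2 ^ (m * 7)      ≡⟨ cong (2 ^ 15 *_) (ℕ.^-*-assoc 2 m 7) ⟨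
    2 ^ 15 * (2 ^ m) ^ 7      ∎
    where
    open ≡-Reasoning
    8[1+7u]≡15+m*7 : ∀ w → 8 * (1 + 7 * (2 + w)) ≡ 15 + (w + (1 + 7 * (2 + w))) * 7
    8[1+7u]≡15+m*7 = solve-∀

mainTheorem15 : (k : ℕ) → 4 ≤ k →
    let m   = 2 ^ k ∸ 1
        m'  = 2 ^ (k ∸ 3) ∸ 1
        p   = fib (m + 1)
        q₁  = fib 1
        q₂  = fib m
        n   = 2 ^ (m ∸ m' ∸ 2) ∸ 2 ^ (m' ∸ 1)
        n'  = 2 ^ (m ∸ m' ∸ 2) + 2 ^ (m' ∸ 1)
        N   = 2 ^ m
    in (dist∞ (lpPoint p q₁ q₂ n) (lpPoint p q₁ q₂ n')
          ≡ (+ 1 / 2 ^ (m ∸ m')) {{m^n≢0 2 (m ∸ m')}})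
       × ∃ λ r → qInf (lpSet p q₁ q₂) ≡ just r
                 × r ^ℚ 8 ℚ.≤ (+ 1 / (2 ^ 15 * N ^ 7)) {{m*n≢0 (2 ^ 15) (N ^ 7) {{m^n≢0 2 15}} {{m^n≢0 N 7 {{m^n≢0 2 m}}}}}}
mainTheorem15 (suc (suc (suc (suc t)))) (s≤s (s≤s (s≤s (s≤s _)))) =
  fibonacci-close-pair w (2 ^ k ∸ 1) (2 ^ (k ∸ 3) ∸ 1) (fib (2 ^ k ∸ 1 + 1)) (fib (2 ^ k ∸ 1)) m≡ m′≡ fib-top fib-bottom
  where
  k u w : ℕ
  k = 4 + t
  u = 2 ^ suc t
  w = u ∸ 2
  u≡2+w : u ≡ 2 + w
  u≡2+w = sym (ℕ.m+[n∸m]≡n (ℕ.^-monoʳ-≤ 2 {1} {suc t} (s≤s z≤n)))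
  m≡mersenne : 2 ^ k ∸ 1 ≡ mersenne k
  m≡mersenne = cong (_∸ 1) (sym (1+mersenne k))
  m≡ : 2 ^ k ∸ 1 ≡ w + (1 + 7 * (2 + w))
  m≡ = cong (_∸ 1) (trans (cong (λ v → 2 * (2 * (2 * v))) u≡2+w) (8[2+w]≡1+[w+[1+7[2+w]]] w))
    where
    8[2+w]≡1+[w+[1+7[2+w]]] : ∀ w → 2 * (2 * (2 * (2 + w))) ≡ 1 + (w + (1 + 7 * (2 + w)))
    8[2+w]≡1+[w+[1+7[2+w]]] = solve-∀
  m′≡ : 2 ^ (k ∸ 3) ∸ 1 ≡ 1 + w
  m′≡ = cong (_∸ 1) u≡2+w
  fib-top : ⟦ fib (2 ^ k ∸ 1 + 1) ⟧ ≗ monomial (2 ^ k ∸ 1)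
  fib-top i = trans (⟦fib⟧-cong (trans (ℕ.+-comm _ 1) (cong suc m≡mersenne)) i)
                    (trans (fib-2^ k i) (monomial-cong (sym m≡mersenne) i))
  fib-bottom : ⟦ fib (2 ^ k ∸ 1) ⟧ ≈ fibLow (2 + w) mod-x^ (1 + 7 * (2 + w))
  fib-bottom = subst₂ (λ m v → ⟦ fib m ⟧ ≈ fibLow v mod-x^ (1 + 7 * v)) (sym m≡mersenne) u≡2+w (fib-mersenne-fibLow t)
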